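{- Let $x,y$ be indeterminates and let $G$ be a finite graph. For every integer $k$, $$\rho_{x,y}^k(G) = k^{c(G)}\,(x-1)^{\mathrm{rk}(G)}\, T_G\!\left(\frac{k+x-1}{x-1},\, y\right),$$ where $\rho_{x,y}^k$ denotes the $k$-th convolution power of the character $\rho_{x,y}$ (with the convention $0^0=1$).
   Context: Work over the field $\mathbb{F}(x,y)$, $\mathbb{F}$ of characteristic $0$. The graph algebra $\mathcal{G}$ has basis the isomorphism classes of finite graphs (loops and multiple edges allowed), multiplication disjoint union, unit the empty graph, comultiplication $\Delta(G)=\sum_{T\subseteq V(G)}G|_T\otimes G|_{V(G)\setminus T}$ ($G|_T$ the induced subgraph) and counit $\epsilon(G)=1$ if $G$ has no vertices, $0$ otherwise. Characters are multiplicative linear maps to the ground field; convolution is $(\phi*\psi)(G)=\sum_{T\subseteq V(G)}\phi(G|_T)\psi(G|_{V(G)\setminus T})$; $\phi^0=\epsilon$, $\phi^k$ is the $k$-fold convolution power for $k>0$, and $\phi^k=(\phi^{ -1})^{ -k}$ for $k<0$ where $\phi^{ -1}$ is the convolution inverse. For $A\subseteq E(G)$, $\mathrm{rk}(A)$ is the size of a maximal acyclic subset of $A$ and $\mathrm{nul}(A)=|A|-\mathrm{rk}(A)$; $\mathrm{rk}(G)=\mathrm{rk}(E(G))$, and $c(G)$ is the number of connected components. The Tutte polynomial is $T_G(x,y)=\sum_{A\subseteq E(G)}(x-1)^{\mathrm{rk}(G)-\mathrm{rk}(A)}(y-1)^{\mathrm{nul}(A)}$, and the rank-nullity polynomial is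 $R_G(x,y)=\sum_{A\subseteq E(G)}(x-1)^{\mathrm{rk}(A)}(y-1)^{\mathrm{nul}(A)}$. The character $\rho_{x,y}$ is $G\mapsto R_G(x,y)$. -}

module Defs where

open import Level using (Level)
open import Data.Bool using (Bool; true; false; _∧_; _∨_; not; if_then_else_)
open import Data.Nat as ℕ using (ℕ; zero; suc; _∸_; _<ᵇ_; _≡ᵇ_)
open import Data.Integer as ℤ using (ℤ; +_; -[1+_])
open import Data.Fin as Fin using (Fin; toℕ)
open import Data.Fin.Subset using (Subset; ⊤; ⊥; _─_; ⁅_⁆; _∪_; inside; outside)
open import Data.Vec as Vec using (Vec; []; _∷_; lookup; tabulate)
open import Data.List as List using (List; []; _∷_; _++_; map; length; foldr)
open import Data.Product using (_×_; _,_; proj₁; proj₂)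
open import Algebra.Bundles using (CommutativeRing)

-- Finite graphs (loops and multiple edges allowed).
-- Vertices are Fin n; edges form a list of (unordered) endpoint pairs,
-- so parallel edges are distinct list entries.

record Graph : Set where
  constructor mkGraph
  field
    n     : ℕ
    edges : List (Fin n × Fin n)
open Graph public

-- all sub-multisets of a list, taken by position (the subsets A ⊆ E)
sublists : {A : Set} → List A → List (List A)
sublists []       = [] ∷ []
sublists (x ∷ xs) = map (x ∷_) (sublists xs) ++ sublists xs

picks : {A : Set} → List A → List (A × List A)
picks []       = []
picks (x ∷ xs) = (x , xs) ∷ map (λ p → proj₁ p , x ∷ proj₂ p) (picks xs)

filterᵇ : {A : Set} → (A → Bool) → List A → List A
filterᵇ p []       = []
filterᵇ p (x ∷ xs) = if p x then x ∷ filterᵇ p xs else filterᵇ p xs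

allᵇ : {A : Set} → (A → Bool) → List A → Bool
allᵇ p = foldr (λ a b → p a ∧ b) true

anyᵇ : {A : Set} → (A → Bool) → List A → Bool
anyᵇ p = foldr (λ a b → p a ∨ b) false

maxℕ : List ℕ → ℕ
maxℕ = foldr ℕ._⊔_ 0

countᵇ : {A : Set} → (A → Bool) → List A → ℕ
countᵇ p xs = length (filterᵇ p xs)

subsetsOf : ∀ {n} → Subset n → List (Subset n)
subsetsOf []            = [] ∷ []
subsetsOf (inside  ∷ S) = map (outside ∷_) (subsetsOf S) ++ map (inside ∷_) (subsetsOf S)
subsetsOf (outside ∷ S) = map (outside ∷_) (subsetsOf S)

isEmptyᵇ : ∀ {n} → Subset n → Bool
isEmptyᵇ []       = true
isEmptyᵇ (b ∷ S)  = not b ∧ isEmptyᵇ S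

sizeˢ : ∀ {n} → Subset n → ℕ
sizeˢ []            = 0
sizeˢ (inside  ∷ S) = suc (sizeˢ S)
sizeˢ (outside ∷ S) = sizeˢ S

allFins : ∀ n → List (Fin n)
allFins n = Vec.toList (tabulate (λ i → i))

-- Connectivity in the graph with vertex set Fin n and edge list es.
-- reach k u = the set of vertices joined to u by a walk with ≤ k edges.

step : ∀ {n} → List (Fin n × Fin n) → Subset n → Subset n
step es S = foldr (λ e T → let a = proj₁ e ; b = proj₂ e in
                      (if lookup S a then ⁅ b ⁆ else ⊥) ∪
                      ((if lookup S b then ⁅ a ⁆ else ⊥) ∪ T)) S es

reachWithin : ∀ {n} → ℕ → List (Fin n × Fin n) → Fin n → Subset n
reachWithin zero    es u = ⁅ u ⁆
reachWithin (suc k) es u = step es (reachWithin k es u)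

-- u and v are connected by a walk (walks of length ≤ n suffice)
connectedᵇ : ∀ {n} → List (Fin n × Fin n) → Fin n → Fin n → Bool
connectedᵇ {n} es u v = lookup (reachWithin n es u) v

-- number of connected components of the graph with vertex set V and
-- edge list es (edges assumed to lie inside V): the number of vertices of
-- V that are the least vertex (in Fin order) of their component.
components : ∀ {n} → Subset n → List (Fin n × Fin n) → ℕ
components {n} V es =
  countᵇ (λ v → lookup V v ∧
                not (anyᵇ (λ u → lookup V u ∧ (toℕ u <ᵇ toℕ v) ∧ connectedᵇ es u v)
                          (allFins n)))
         (allFins n)

-- An edge set B is acyclic iff no edge of B lies on a cycle of B, i.e. for
-- every edge e = ab of B, a and b are not joined by a walk in B ∖ {e}
-- (a loop is never acyclic; two parallel edges are never acyclic).

acyclicᵇ : ∀ {n} → List (Fin n × Fin n) → Bool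
acyclicᵇ B = allᵇ (λ p → not (connectedᵇ (proj₂ p) (proj₁ (proj₁ p)) (proj₂ (proj₁ p))))
                  (picks B)

rk : ∀ {n} → List (Fin n × Fin n) → ℕ
rk A = maxℕ (map length (filterᵇ acyclicᵇ (sublists A)))

nul : ∀ {n} → List (Fin n × Fin n) → ℕ
nul A = length A ∸ rk A

inducedEdges : (G : Graph) → Subset (n G) → List (Fin (n G) × Fin (n G))
inducedEdges G S = filterᵇ (λ e → lookup S (proj₁ e) ∧ lookup S (proj₂ e)) (edges G)

cInd : (G : Graph) → Subset (n G) → ℕ
cInd G S = components S (inducedEdges G S)

rkInd : (G : Graph) → Subset (n G) → ℕ
rkInd G S = rk (inducedEdges G S)

module WithRing {c ℓ : Level} (R : CommutativeRing c ℓ) where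
  open CommutativeRing R public

  _−_ : Carrier → Carrier → Carrier
  a − b = a + (- b)

  -- a ^ m, with a ^ 0 = 1 (so 0^0 = 1)
  _^_ : Carrier → ℕ → Carrier
  a ^ zero  = 1#
  a ^ suc m = a * (a ^ m)

  Σ : {A : Set} → (A → Carrier) → List A → Carrier
  Σ f = foldr (λ a r → f a + r) 0#

  fromℕ : ℕ → Carrier
  fromℕ zero    = 0#
  fromℕ (suc m) = 1# + fromℕ m

  fromℤ : ℤ → Carrier
  fromℤ (+ m)     = fromℕ m
  fromℤ -[1+ m ]  = - fromℕ (suc m)

  tutte : (G : Graph) → Subset (n G) → Carrier → Carrier → Carrier
  tutte G S X Y =
    Σ (λ A → ((X − 1#) ^ (rkInd G S ∸ rk A)) * ((Y − 1#) ^ nul A))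
      (sublists (inducedEdges G S))

  rankNullity : (G : Graph) → Subset (n G) → Carrier → Carrier → Carrier
  rankNullity G S x y =
    Σ (λ A → ((x − 1#) ^ rk A) * ((y − 1#) ^ nul A))
      (sublists (inducedEdges G S))

  -- Linear maps on the graph algebra, evaluated on basis graphs.
  -- φ G S is the value of φ on the induced subgraph G|_S.

  GFun : Set c
  GFun = (G : Graph) → Subset (n G) → Carrier

  ε : GFun
  ε G S = if isEmptyᵇ S then 1# else 0#

  _⋆_ : GFun → GFun → GFun
  (φ ⋆ ψ) G S = Σ (λ T → φ G T * ψ G (S ─ T)) (subsetsOf S)

  -- convolution inverse, by the recursion coming from φ * φ⁻¹ = ε
  -- (for φ(∅) = 1):  φ⁻¹(G|_S) = - Σ_{∅ ≠ T ⊆ S} φ(G|_T) φ⁻¹(G|_{S∖T}).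
  -- The fuel argument bounds |S|; it is started at n G ≥ |S|.
  invAux : ℕ → GFun → GFun
  invAux zero    φ G S = ε G S
  invAux (suc f) φ G S =
    if isEmptyᵇ S then 1#
    else - Σ (λ T → φ G T * invAux f φ G (S ─ T))
             (filterᵇ (λ T → not (isEmptyᵇ T)) (subsetsOf S))

  inverse : GFun → GFun
  inverse φ G S = invAux (n G) φ G S

  powℕ : GFun → ℕ → GFun
  powℕ φ zero    = ε
  powℕ φ (suc k) = φ ⋆ powℕ φ k

  powℤ : GFun → ℤ → GFun
  powℤ φ (+ k)     = powℕ φ k
  powℤ φ -[1+ k ]  = powℕ (inverse φ) (suc k)

  ρ : Carrier → Carrier → GFun
  ρ x y G S = rankNullity G S x y

module Submission where

open import Defs
open import Level using (Level)
open import Data.Integer using (ℤ)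
open import Data.Fin.Subset using (⊤)
open import Algebra.Bundles using (CommutativeRing)

-- For τ in the ring let ψ_τ(G|S) = Σ_{A ⊆ E(G|S)} τ^{c(S,A)} (x-1)^{rk A} (y-1)^{nul A},
-- c(S,A) being the number of components of (S, A).  Then ψ_1 = ρ_{x,y},
-- ψ_0 = ε and ψ_σ ⋆ ψ_τ = ψ_{σ+τ}: a term (T, A) of the convolution is an
-- edge set A together with a colouring of the components of (S, A) by σ
-- and τ, and rank and nullity add up over such splittings.  So ρ^k = ψ_k
-- for every k ∈ ℤ (for k < 0 by uniqueness of inverses), and the rank
-- formula rk A + c(S,A) = |S| rewrites ψ_k(G) as k^{c(G)} (x-1)^{rk G} T_G(…, y).

module GraphTheory where

  open import Data.Bool using (Bool; true; false; _∧_; _∨_; not; if_then_else_; T)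
  open import Data.Bool.Properties using (∧-zeroʳ; ∧-identityʳ; ∨-identityʳ)
  open import Data.Unit using (tt)
  open import Data.Nat as ℕ using (ℕ; zero; suc; _+_; _∸_; _≤_; _<_; s≤s; z≤n; _<ᵇ_)
  import Data.Nat.Properties as ℕP
  open import Algebra.Properties.CommutativeSemigroup ℕP.+-commutativeSemigroup using () renaming (interchange to +-interchange)
  open import Data.Fin as Fin using (Fin; toℕ)
  import Data.Fin.Properties as FinP
  open import Data.Fin.Subset using (Subset; ⊤; ⊥; _─_; ⁅_⁆; _∪_; ∁; inside; outside)
  open import Data.Vec as Vec using ([]; _∷_; lookup; tabulate)
  open import Data.Vec.Properties using (lookup-zipWith; lookup-replicate; lookup∘tabulate; lookup-map)
  open import Data.List as List using (List; []; _∷_; map; length; _++_)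
  open import Data.List.Membership.Propositional using (_∈_)
  open import Data.List.Membership.Propositional.Properties using (∈-map⁺; ∈-map⁻; ∈-++⁺ˡ; ∈-++⁺ʳ; ∈-++⁻)
  open import Data.List.Relation.Unary.Any using (here; there)
  open import Data.Product as Prod using (_×_; _,_; proj₁; proj₂; ∃)
  open import Data.Sum as Sum using (_⊎_; inj₁; inj₂; [_,_])
  open import Data.Empty using (⊥-elim) renaming (⊥ to Empty)
  open import Relation.Binary.PropositionalEquality using (_≡_; _≢_; refl; sym; trans; cong; cong₂; subst; module ≡-Reasoning)
  open import Relation.Binary.Definitions using (Tri; tri<; tri≈; tri>)
  open import Relation.Nullary using (¬_; yes; no)
  open import Relation.Nullary.Decidable using (⌊_⌋)
  open import Function using (_∘_)

  -- Booleans are compared with `true` throughout: these are the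
  -- introduction and elimination rules of ∧, ∨ and not in that form.

  ∧-elim : ∀ a b → a ∧ b ≡ true → a ≡ true × b ≡ true
  ∧-elim true true _ = refl , refl

  ∧-intro : ∀ {a b} → a ≡ true → b ≡ true → a ∧ b ≡ true
  ∧-intro refl refl = refl

  ∨-elim : ∀ a b → a ∨ b ≡ true → a ≡ true ⊎ b ≡ true
  ∨-elim true  b _ = inj₁ refl
  ∨-elim false b p = inj₂ p

  ∨-introˡ : ∀ a b → a ≡ true → a ∨ b ≡ true
  ∨-introˡ .true b refl = refl

  ∨-introʳ : ∀ a b → b ≡ true → a ∨ b ≡ true
  ∨-introʳ true  b p = refl
  ∨-introʳ false b p = p

  not-intro : ∀ {a} → a ≡ false → not a ≡ true
  not-intro refl = refl

  not-elim : ∀ {a} → not a ≡ true → a ≡ false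
  not-elim {false} _ = refl

  true≢false : ∀ {a} → a ≡ true → a ≡ false → Empty
  true≢false refl ()

  ¬true⇒false : ∀ {a} → (a ≡ true → Empty) → a ≡ false
  ¬true⇒false {false} _ = refl
  ¬true⇒false {true}  h = ⊥-elim (h refl)

  _==ᵇ_ : Bool → Bool → Bool
  true  ==ᵇ b = b
  false ==ᵇ b = not b

  ==ᵇ-sound : ∀ {a b} → (a ==ᵇ b) ≡ true → a ≡ b
  ==ᵇ-sound {true}  {true}  _ = refl
  ==ᵇ-sound {false} {false} _ = refl

  ==ᵇ-refl : ∀ a → (a ==ᵇ a) ≡ true
  ==ᵇ-refl true  = refl
  ==ᵇ-refl false = refl

  ≡⇒==ᵇ : ∀ {a b} → a ≡ b → (a ==ᵇ b) ≡ true
  ≡⇒==ᵇ {a} refl = ==ᵇ-refl a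

  ==ᵇ-∨ : ∀ c t₁a t₁b t₂a t₂b → (t₁a ≡ true → c ≡ true) → (t₁b ≡ true → c ≡ true) →
          (t₂a ≡ true → c ≡ false) → (t₂b ≡ true → c ≡ false) →
          ((t₁a ∨ t₂a) ==ᵇ (t₁b ∨ t₂b)) ≡ (t₁a ==ᵇ t₁b) ∧ (t₂a ==ᵇ t₂b)
  ==ᵇ-∨ true t₁a t₁b t₂a t₂b _ _ h₃ h₄
    rewrite ¬true⇒false (λ e → true≢false refl (h₃ e)) | ¬true⇒false (λ e → true≢false refl (h₄ e))
          | ∨-identityʳ t₁a | ∨-identityʳ t₁b = sym (∧-identityʳ (t₁a ==ᵇ t₁b))
  ==ᵇ-∨ false t₁a t₁b t₂a t₂b h₁ h₂ _ _
    rewrite ¬true⇒false (λ e → true≢false (h₁ e) refl) | ¬true⇒false (λ e → true≢false (h₂ e) refl) = refl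

  bool-ext : ∀ {a b : Bool} → (a ≡ true → b ≡ true) → (b ≡ true → a ≡ true) → a ≡ b
  bool-ext {true}  {true}  f g = refl
  bool-ext {true}  {false} f g = sym (f refl)
  bool-ext {false} {true}  f g = g refl
  bool-ext {false} {false} f g = refl

  <ᵇ-elim : ∀ m n → (m <ᵇ n) ≡ true → m < n
  <ᵇ-elim m n p = ℕP.<ᵇ⇒< m n (subst T (sym p) tt)

  <ᵇ-intro : ∀ {m n} → m < n → (m <ᵇ n) ≡ true
  <ᵇ-intro {m} {n} lt with m <ᵇ n | ℕP.<⇒<ᵇ lt
  ... | true | _ = refl

  -- Vertex sets are Subset n.  Membership is wrapped in a record so that
  -- the set stays visible to the type checker; inclusion is stated on the
  -- underlying booleans.

  infix 4 _∈ₛ_ _⊆_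

  record _∈ₛ_ {n} (i : Fin n) (S : Subset n) : Set where
    constructor mk
    field get : lookup S i ≡ true
  open _∈ₛ_ public

  _⊆_ : ∀ {n} → Subset n → Subset n → Set
  T ⊆ S = ∀ i → lookup T i ≡ true → lookup S i ≡ true

  module _ {n : ℕ} where

    lookup-∪ : ∀ (p q : Subset n) i → lookup (p ∪ q) i ≡ lookup p i ∨ lookup q i
    lookup-∪ p q i = lookup-zipWith _∨_ i p q

    lookup-⊥ : ∀ i → lookup (⊥ {n}) i ≡ false
    lookup-⊥ i = lookup-replicate i false

    lookup-⊤ : ∀ i → lookup (⊤ {n}) i ≡ true
    lookup-⊤ i = lookup-replicate i true

    lookup-∁ : ∀ (p : Subset n) i → lookup (∁ p) i ≡ not (lookup p i)
    lookup-∁ p i = lookup-map i not p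

  lookup-─ : ∀ {n} (p q : Subset n) i → lookup (p ─ q) i ≡ lookup p i ∧ not (lookup q i)
  lookup-─ (x ∷ p) (true  ∷ q) Fin.zero = sym (∧-zeroʳ x)
  lookup-─ (x ∷ p) (false ∷ q) Fin.zero = sym (∧-identityʳ x)
  lookup-─ (x ∷ p) (y ∷ q) (Fin.suc i) = lookup-─ p q i

  lookup-⁅⁆-self : ∀ {n} (i : Fin n) → lookup ⁅ i ⁆ i ≡ true
  lookup-⁅⁆-self Fin.zero    = refl
  lookup-⁅⁆-self (Fin.suc i) = lookup-⁅⁆-self i

  lookup-⁅⁆ : ∀ {n} (j i : Fin n) → lookup ⁅ j ⁆ i ≡ true → i ≡ j
  lookup-⁅⁆ Fin.zero    Fin.zero    p = refl
  lookup-⁅⁆ Fin.zero    (Fin.suc i) p = ⊥-elim (true≢false p (lookup-replicate i false))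
  lookup-⁅⁆ (Fin.suc j) (Fin.suc i) p = cong Fin.suc (lookup-⁅⁆ j i p)

  ─-member : ∀ {n} (S T : Subset n) i → lookup (S ─ T) i ≡ true → lookup S i ≡ true × lookup T i ≡ false
  ─-member S T i e with ∧-elim (lookup S i) _ (trans (sym (lookup-─ S T i)) e)
  ... | e₁ , e₂ = e₁ , not-elim e₂

  empty-or-member : ∀ {n} (S : Subset n) → (∀ i → lookup S i ≡ false) ⊎ ∃ (λ v → lookup S v ≡ true)
  empty-or-member []          = inj₁ (λ ())
  empty-or-member (true ∷ S)  = inj₂ (Fin.zero , refl)
  empty-or-member (false ∷ S) with empty-or-member S
  ... | inj₁ h       = inj₁ λ { Fin.zero → refl ; (Fin.suc i) → h i }
  ... | inj₂ (v , e) = inj₂ (Fin.suc v , e)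

  subset-ext : ∀ {m} (u v : Subset m) → (∀ i → lookup u i ≡ lookup v i) → u ≡ v
  subset-ext []      []      h = refl
  subset-ext (a ∷ u) (b ∷ v) h = cong₂ _∷_ (h Fin.zero) (subset-ext u v (h ∘ Fin.suc))

  sameᵇ : ∀ {m} → Subset m → Subset m → Bool
  sameᵇ []      []      = true
  sameᵇ (b ∷ T) (c ∷ X) = (b ==ᵇ c) ∧ sameᵇ T X

  sameᵇ-sound : ∀ {m} (T X : Subset m) → sameᵇ T X ≡ true → T ≡ X
  sameᵇ-sound []      []      _ = refl
  sameᵇ-sound (b ∷ T) (c ∷ X) e with ∧-elim (b ==ᵇ c) _ e
  ... | e₁ , e₂ = cong₂ _∷_ (==ᵇ-sound e₁) (sameᵇ-sound T X e₂)

  sameᵇ-refl : ∀ {m} (T : Subset m) → sameᵇ T T ≡ true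
  sameᵇ-refl []      = refl
  sameᵇ-refl (b ∷ T) = ∧-intro (==ᵇ-refl b) (sameᵇ-refl T)

  subsetsOf-⊆ : ∀ {m} (S : Subset m) {T} → T ∈ subsetsOf S → T ⊆ S
  subsetsOf-⊆ [] (here refl) ()
  subsetsOf-⊆ (true ∷ S) m with ∈-++⁻ (map (outside ∷_) (subsetsOf S)) m
  ... | inj₁ m₁ with ∈-map⁻ (outside ∷_) m₁
  ... | T' , m' , refl = λ { Fin.zero () ; (Fin.suc i) e → subsetsOf-⊆ S m' i e }
  subsetsOf-⊆ (true ∷ S) m | inj₂ m₂ with ∈-map⁻ (inside ∷_) m₂
  ... | T' , m' , refl = λ { Fin.zero e → refl ; (Fin.suc i) e → subsetsOf-⊆ S m' i e }
  subsetsOf-⊆ (false ∷ S) m with ∈-map⁻ (outside ∷_) m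
  ... | T' , m' , refl = λ { Fin.zero () ; (Fin.suc i) e → subsetsOf-⊆ S m' i e }

  isEmptyᵇ-member : ∀ {m} (S : Subset m) v → lookup S v ≡ true → isEmptyᵇ S ≡ false
  isEmptyᵇ-member (true ∷ S)  _           _ = refl
  isEmptyᵇ-member (false ∷ S) (Fin.suc v) e = isEmptyᵇ-member S v e

  isEmptyᵇ-empty : ∀ {m} (S : Subset m) → (∀ i → lookup S i ≡ false) → isEmptyᵇ S ≡ true
  isEmptyᵇ-empty []          h = refl
  isEmptyᵇ-empty (true ∷ S)  h with () ← h Fin.zero
  isEmptyᵇ-empty (false ∷ S) h = isEmptyᵇ-empty S (h ∘ Fin.suc)

  isEmptyᵇ-size : ∀ {m} (S : Subset m) → isEmptyᵇ S ≡ false → 1 ≤ sizeˢ S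
  isEmptyᵇ-size (true ∷ S)  _ = s≤s z≤n
  isEmptyᵇ-size (false ∷ S) e = isEmptyᵇ-size S e

  isEmptyᵇ≡sameᵇ⊥ : ∀ {m} (T : Subset m) → isEmptyᵇ T ≡ sameᵇ T ⊥
  isEmptyᵇ≡sameᵇ⊥ []          = refl
  isEmptyᵇ≡sameᵇ⊥ (true ∷ T)  = refl
  isEmptyᵇ≡sameᵇ⊥ (false ∷ T) = isEmptyᵇ≡sameᵇ⊥ T

  size-mono : ∀ {n} (S S' : Subset n) → S ⊆ S' → sizeˢ S ≤ sizeˢ S'
  size-mono []         []          h = z≤n
  size-mono (true ∷ S) (true ∷ S') h = s≤s (size-mono S S' (h ∘ Fin.suc))
  size-mono (true ∷ S) (false ∷ S') h = ⊥-elim (true≢false (h Fin.zero refl) refl)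
  size-mono (false ∷ S) (true ∷ S') h = ℕP.m≤n⇒m≤1+n (size-mono S S' (h ∘ Fin.suc))
  size-mono (false ∷ S) (false ∷ S') h = size-mono S S' (h ∘ Fin.suc)

  ⊆⇒⊇⊎< : ∀ {n} (S S' : Subset n) → S ⊆ S' → S' ⊆ S ⊎ sizeˢ S < sizeˢ S'
  ⊆⇒⊇⊎< []          []           h = inj₁ (λ ())
  ⊆⇒⊇⊎< (true ∷ S)  (true ∷ S')  h with ⊆⇒⊇⊎< S S' (h ∘ Fin.suc)
  ... | inj₁ q  = inj₁ λ { Fin.zero _ → refl ; (Fin.suc i) p → q i p }
  ... | inj₂ lt = inj₂ (s≤s lt)
  ⊆⇒⊇⊎< (true ∷ S)  (false ∷ S') h = ⊥-elim (true≢false (h Fin.zero refl) refl)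
  ⊆⇒⊇⊎< (false ∷ S) (true ∷ S')  h = inj₂ (s≤s (size-mono S S' (h ∘ Fin.suc)))
  ⊆⇒⊇⊎< (false ∷ S) (false ∷ S') h with ⊆⇒⊇⊎< S S' (h ∘ Fin.suc)
  ... | inj₁ q  = inj₁ λ { Fin.zero p → p ; (Fin.suc i) p → q i p }
  ... | inj₂ lt = inj₂ lt

  size≤n : ∀ {n} (S : Subset n) → sizeˢ S ≤ n
  size≤n []          = z≤n
  size≤n (true ∷ S)  = s≤s (size≤n S)
  size≤n (false ∷ S) = ℕP.m≤n⇒m≤1+n (size≤n S)

  member⇒size≥1 : ∀ {n} (S : Subset n) i → lookup S i ≡ true → 1 ≤ sizeˢ S
  member⇒size≥1 (true ∷ S)  i           p = s≤s z≤n
  member⇒size≥1 (false ∷ S) (Fin.suc i) p = member⇒size≥1 S i p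

  size0⇒empty : ∀ {m} (S : Subset m) → sizeˢ S ≤ 0 → ∀ i → lookup S i ≡ false
  size0⇒empty (false ∷ S) h Fin.zero    = refl
  size0⇒empty (false ∷ S) h (Fin.suc i) = size0⇒empty S h i

  size-split : ∀ {m} (S T : Subset m) → T ⊆ S → sizeˢ S ≡ sizeˢ T + sizeˢ (S ─ T)
  size-split []         []         h = refl
  size-split (true ∷ S) (true ∷ T) h = cong suc (size-split S T (h ∘ Fin.suc))
  size-split (true ∷ S) (false ∷ T) h = trans (cong suc (size-split S T (h ∘ Fin.suc))) (sym (ℕP.+-suc _ _))
  size-split (false ∷ S) (true ∷ T) h with h Fin.zero refl
  ... | ()
  size-split (false ∷ S) (false ∷ T) h = size-split S T (h ∘ Fin.suc)

  ∪─ : ∀ {m} (S T : Subset m) → T ⊆ S → T ∪ (S ─ T) ≡ S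
  ∪─ []          []          h = refl
  ∪─ (true ∷ S)  (true ∷ T)  h = cong (true ∷_) (∪─ S T (h ∘ Fin.suc))
  ∪─ (true ∷ S)  (false ∷ T) h = cong (true ∷_) (∪─ S T (h ∘ Fin.suc))
  ∪─ (false ∷ S) (true ∷ T)  h with h Fin.zero refl
  ... | ()
  ∪─ (false ∷ S) (false ∷ T) h = cong (false ∷_) (∪─ S T (h ∘ Fin.suc))

  ─⊥ : ∀ {m} (S : Subset m) → S ─ ⊥ ≡ S
  ─⊥ []          = refl
  ─⊥ (true ∷ S)  = cong (true ∷_) (─⊥ S)
  ─⊥ (false ∷ S) = cong (false ∷_) (─⊥ S)

  ─-∪ : ∀ {m} (S C T₁ T₂ : Subset m) → C ⊆ S → T₁ ⊆ C → T₂ ⊆ S ─ C →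
        S ─ (T₁ ∪ T₂) ≡ (C ─ T₁) ∪ ((S ─ C) ─ T₂)
  ─-∪ S C T₁ T₂ C⊆S T₁⊆C T₂⊆S─C = subset-ext _ _ λ i → begin
    lookup (S ─ (T₁ ∪ T₂)) i
      ≡⟨ trans (lookup-─ S (T₁ ∪ T₂) i) (cong (λ z → lookup S i ∧ not z) (lookup-∪ T₁ T₂ i)) ⟩
    lookup S i ∧ not (lookup T₁ i ∨ lookup T₂ i)
      ≡⟨ pointwise (lookup S i) (lookup C i) (lookup T₁ i) (lookup T₂ i) (C⊆S i) (T₁⊆C i)
              (λ e → trans (sym (lookup-─ S C i)) (T₂⊆S─C i e)) ⟩
    (lookup C i ∧ not (lookup T₁ i)) ∨ ((lookup S i ∧ not (lookup C i)) ∧ not (lookup T₂ i))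
      ≡⟨ sym (cong₂ _∨_ (lookup-─ C T₁ i) (trans (lookup-─ (S ─ C) T₂ i) (cong (_∧ not (lookup T₂ i)) (lookup-─ S C i)))) ⟩
    lookup (C ─ T₁) i ∨ lookup ((S ─ C) ─ T₂) i
      ≡⟨ sym (lookup-∪ (C ─ T₁) ((S ─ C) ─ T₂) i) ⟩
    lookup ((C ─ T₁) ∪ ((S ─ C) ─ T₂)) i ∎
    where
    pointwise : ∀ s c t₁ t₂ → (c ≡ true → s ≡ true) → (t₁ ≡ true → c ≡ true) → (t₂ ≡ true → s ∧ not c ≡ true) →
           s ∧ not (t₁ ∨ t₂) ≡ (c ∧ not t₁) ∨ ((s ∧ not c) ∧ not t₂)
    pointwise s     true  t₁ true  _  _  h₃ = ⊥-elim (true≢false (h₃ refl) (∧-zeroʳ s))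
    pointwise s     false true t₂  _  h₂ _  with () ← h₂ refl
    pointwise false true  t₁ false h₁ _  _  with () ← h₁ refl
    pointwise true  true  t₁ false _  _  _  = trans (cong not (∨-identityʳ t₁)) (sym (∨-identityʳ (not t₁)))
    pointwise s     false false t₂ _  _  _  = cong (_∧ not t₂) (sym (∧-identityʳ s))
    open ≡-Reasoning

  -- A vertex set X is closed under an edge
  -- list es if no edge of es leaves X.  reachWithin k es u (from Defs) is the
  -- set reached from u by walks of length ≤ k; after n steps it is the
  -- least closed set containing u, which makes `conn es` an equivalence
  -- relation, monotone in es.

  Edges : ℕ → Set
  Edges n = List (Fin n × Fin n)

  module _ {n : ℕ} where

    Closed : Edges n → Subset n → Set
    Closed es X = ∀ {a b} → (a , b) ∈ es → (a ∈ₛ X → b ∈ₛ X) × (b ∈ₛ X → a ∈ₛ X)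

    Closed-sub : ∀ {es es'} X → (∀ {e} → e ∈ es → e ∈ es') → Closed es' X → Closed es X
    Closed-sub X sub c m = c (sub m)

    Closed-≡ : ∀ {es} X Y → X ⊆ Y → Y ⊆ X → Closed es X → Closed es Y
    Closed-≡ X Y xy yx c m =
      (λ p → mk (xy _ (get (proj₁ (c m) (mk (yx _ (get p))))))) ,
      (λ p → mk (xy _ (get (proj₂ (c m) (mk (yx _ (get p)))))))

    private
      if-⁅⁆ : ∀ (c : Bool) (b i : Fin n) → lookup (if c then ⁅ b ⁆ else ⊥) i ≡ true → c ≡ true × i ≡ b
      if-⁅⁆ true  b i p = refl , lookup-⁅⁆ b i p
      if-⁅⁆ false b i p = ⊥-elim (true≢false p (lookup-⊥ i))

      if-⁅⁆-self : ∀ (c : Bool) (b : Fin n) → c ≡ true → lookup (if c then ⁅ b ⁆ else ⊥) b ≡ true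
      if-⁅⁆-self .true b refl = lookup-⁅⁆-self b

      lookup-step : ∀ a b (es : Edges n) (S : Subset n) i → lookup (step ((a , b) ∷ es) S) i ≡
                    lookup (if lookup S a then ⁅ b ⁆ else ⊥) i ∨
                    (lookup (if lookup S b then ⁅ a ⁆ else ⊥) i ∨ lookup (step es S) i)
      lookup-step a b es S i =
        trans (lookup-∪ (if lookup S a then ⁅ b ⁆ else ⊥) _ i)
              (cong (lookup (if lookup S a then ⁅ b ⁆ else ⊥) i ∨_)
                    (lookup-∪ (if lookup S b then ⁅ a ⁆ else ⊥) (step es S) i))

      step-new₁ : ∀ a b es S i → lookup (if lookup S a then ⁅ b ⁆ else ⊥) i ≡ true → i ∈ₛ step ((a , b) ∷ es) S
      step-new₁ a b es S i p = mk (trans (lookup-step a b es S i) (∨-introˡ _ _ p))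

      step-new₂ : ∀ a b es S i → lookup (if lookup S b then ⁅ a ⁆ else ⊥) i ≡ true → i ∈ₛ step ((a , b) ∷ es) S
      step-new₂ a b es S i p =
        mk (trans (lookup-step a b es S i)
              (∨-introʳ (lookup (if lookup S a then ⁅ b ⁆ else ⊥) i) _ (∨-introˡ _ (lookup (step es S) i) p)))

      step-old : ∀ a b es S i → i ∈ₛ step es S → i ∈ₛ step ((a , b) ∷ es) S
      step-old a b es S i p =
        mk (trans (lookup-step a b es S i)
              (∨-introʳ (lookup (if lookup S a then ⁅ b ⁆ else ⊥) i) _
                (∨-introʳ (lookup (if lookup S b then ⁅ a ⁆ else ⊥) i) _ (get p))))

    step-⊇ : ∀ es S → S ⊆ step es S
    step-⊇ []              S i p = p
    step-⊇ ((a , b) ∷ es) S i p = get (step-old a b es S i (mk (step-⊇ es S i p)))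

    step-edge : ∀ es S {a b} → (a , b) ∈ es → (a ∈ₛ S → b ∈ₛ step es S) × (b ∈ₛ S → a ∈ₛ step es S)
    step-edge ((a , b) ∷ es) S (here refl) =
      (λ p → step-new₁ a b es S b (if-⁅⁆-self _ b (get p))) ,
      (λ p → step-new₂ a b es S a (if-⁅⁆-self _ a (get p)))
    step-edge ((a' , b') ∷ es) S {a} {b} (there m) =
      (λ p → step-old a' b' es S b (proj₁ (step-edge es S m) p)) ,
      (λ p → step-old a' b' es S a (proj₂ (step-edge es S m) p))

    step-least : ∀ es S X → Closed es X → S ⊆ X → step es S ⊆ X
    step-least []              S X c sx i p = sx i p
    step-least ((a , b) ∷ es) S X c sx i p with ∨-elim _ _ (trans (sym (lookup-step a b es S i)) p)
    ... | inj₁ q with if-⁅⁆ (lookup S a) b i q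
    ... | sa , refl = get (proj₁ (c (here refl)) (mk (sx a sa)))
    step-least ((a , b) ∷ es) S X c sx i p | inj₂ q with ∨-elim _ _ q
    ... | inj₁ r with if-⁅⁆ (lookup S b) a i r
    ... | sb , refl = get (proj₂ (c (here refl)) (mk (sx b sb)))
    step-least ((a , b) ∷ es) S X c sx i p | inj₂ q | inj₂ r = step-least es S X (c ∘ there) sx i r

    stable⇒Closed : ∀ es S → step es S ⊆ S → Closed es S
    stable⇒Closed es S h m = (λ p → mk (h _ (get (proj₁ (step-edge es S m) p)))) ,
                             (λ p → mk (h _ (get (proj₂ (step-edge es S m) p))))

    -- After k steps, either the reached set is already closed or it has
    -- more than k elements; hence it is closed after n steps.
    reach-grows : ∀ es u k → Closed es (reachWithin k es u) ⊎ k < sizeˢ (reachWithin k es u)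
    reach-grows es u zero = inj₂ (member⇒size≥1 (reachWithin zero es u) u (lookup-⁅⁆-self u))
    reach-grows es u (suc k) = grow (⊆⇒⊇⊎< R (step es R) (step-⊇ es R)) (reach-grows es u k)
      where
      R = reachWithin k es u
      grow : step es R ⊆ R ⊎ sizeˢ R < sizeˢ (step es R) → Closed es R ⊎ k < sizeˢ R →
             Closed es (step es R) ⊎ suc k < sizeˢ (step es R)
      grow (inj₁ q)  _          = inj₁ (Closed-≡ R (step es R) (step-⊇ es R) q (stable⇒Closed es R q))
      grow (inj₂ lt) (inj₁ c)   = inj₁ (Closed-≡ R (step es R) (step-⊇ es R) (step-least es R R c (λ i p → p)) c)
      grow (inj₂ lt) (inj₂ lt') = inj₂ (ℕP.≤-trans (s≤s lt') lt)

    reach-closed : ∀ es u → Closed es (reachWithin n es u)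
    reach-closed es u with reach-grows es u n
    ... | inj₁ c  = c
    ... | inj₂ lt = ⊥-elim (ℕP.<-irrefl refl (ℕP.<-≤-trans lt (size≤n (reachWithin n es u))))

    reach-least : ∀ es u X → Closed es X → u ∈ₛ X → ∀ k → reachWithin k es u ⊆ X
    reach-least es u X c ux zero i p with lookup-⁅⁆ u i p
    ... | refl = get ux
    reach-least es u X c ux (suc k) = step-least es _ X c (reach-least es u X c ux k)

    reach-self : ∀ es u k → u ∈ₛ reachWithin k es u
    reach-self es u zero    = mk (lookup-⁅⁆-self u)
    reach-self es u (suc k) = mk (step-⊇ es _ u (get (reach-self es u k)))

    conn : Edges n → Fin n → Fin n → Set
    conn es u v = v ∈ₛ reachWithin n es u

    conn-closed : ∀ {es u v} X → Closed es X → u ∈ₛ X → conn es u v → v ∈ₛ X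
    conn-closed {es} {u} {v} X c ux p = mk (reach-least es u X c ux n v (get p))

    conn-refl : ∀ {es} u → conn es u u
    conn-refl {es} u = reach-self es u n

    conn-trans : ∀ {es u v w} → conn es u v → conn es v w → conn es u w
    conn-trans {es} {u} p q = conn-closed (reachWithin n es u) (reach-closed es u) p q

    conn-edge : ∀ {es a b} → (a , b) ∈ es → conn es a b
    conn-edge {es} {a} m = proj₁ (reach-closed es a m) (conn-refl a)

    conn-edge' : ∀ {es a b} → (a , b) ∈ es → conn es b a
    conn-edge' {es} {a} {b} m = proj₂ (reach-closed es b m) (conn-refl b)

    -- symmetry: the set of vertices connected *to* u is closed and contains u
    conn-sym : ∀ {es u v} → conn es u v → conn es v u
    conn-sym {es} {u} {v} p = mk (trans (sym (lookup∘tabulate _ v)) (get (conn-closed Y cY uY p)))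
      where
      Y : Subset n
      Y = tabulate (λ w → connectedᵇ es w u)
      toY : ∀ {w} → conn es w u → w ∈ₛ Y
      toY {w} c = mk (trans (lookup∘tabulate _ w) (get c))
      fromY : ∀ {w} → w ∈ₛ Y → conn es w u
      fromY {w} c = mk (trans (sym (lookup∘tabulate _ w)) (get c))
      uY : u ∈ₛ Y
      uY = toY (conn-refl u)
      cY : Closed es Y
      cY m = (λ pa → toY (conn-trans (conn-edge' m) (fromY pa))) ,
             (λ pb → toY (conn-trans (conn-edge m) (fromY pb)))

    conn-transfer : ∀ {es es' u v} → (∀ X → Closed es' X → Closed es X) → conn es u v → conn es' u v
    conn-transfer {es} {es'} {u} h p = conn-closed (reachWithin n es' u) (h _ (reach-closed es' u)) (conn-refl u) p

    conn-mono : ∀ {es es' u v} → (∀ {e} → e ∈ es → e ∈ es') → conn es u v → conn es' u v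
    conn-mono sub = conn-transfer (λ X c → Closed-sub X sub c)

    Closed⇒same : ∀ {es X a b} → Closed es X → (a , b) ∈ es → lookup X a ≡ lookup X b
    Closed⇒same c m = bool-ext (λ e → get (proj₁ (c m) (mk e))) (λ e → get (proj₂ (c m) (mk e)))

    same⇒Closed : ∀ {es} X → (∀ {a b} → (a , b) ∈ es → lookup X a ≡ lookup X b) → Closed es X
    same⇒Closed X h m = (λ p → mk (trans (sym (h m)) (get p))) , (λ p → mk (trans (h m) (get p)))

    Closed-∁ : ∀ {es} X → Closed es X → Closed es (∁ X)
    Closed-∁ X c = same⇒Closed (∁ X) λ {a} {b} m →
      trans (lookup-∁ X a) (trans (cong not (Closed⇒same c m)) (sym (lookup-∁ X b)))

    Closed-─ : ∀ {es} X Y → Closed es X → Closed es Y → Closed es (X ─ Y)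
    Closed-─ X Y cX cY = same⇒Closed (X ─ Y) λ {a} {b} m →
      trans (lookup-─ X Y a) (trans (cong₂ (λ p q → p ∧ not q) (Closed⇒same cX m) (Closed⇒same cY m)) (sym (lookup-─ X Y b)))

  count : ∀ {n} → (Fin n → Bool) → ℕ
  count {zero}  p = 0
  count {suc n} p = if p Fin.zero then suc (count (p ∘ Fin.suc)) else count (p ∘ Fin.suc)

  countᵇ-allFins : ∀ {n} (p : Fin n → Bool) → countᵇ p (allFins n) ≡ count p
  countᵇ-allFins p = over-tabulate p (λ i → i)
    where
    over-tabulate : ∀ {n} {A : Set} (p : A → Bool) (f : Fin n → A) → countᵇ p (Vec.toList (tabulate f)) ≡ count (p ∘ f)
    over-tabulate {zero}  p f = refl
    over-tabulate {suc n} p f with p (f Fin.zero)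
    ... | true  = cong suc (over-tabulate p (f ∘ Fin.suc))
    ... | false = over-tabulate p (f ∘ Fin.suc)

  anyᵇ-allFins : ∀ {n} (p : Fin n → Bool) → anyᵇ p (allFins n) ≡ true → ∃ λ i → p i ≡ true
  anyᵇ-allFins p = over-tabulate p (λ i → i)
    where
    over-tabulate : ∀ {n} {A : Set} (p : A → Bool) (f : Fin n → A) →
         anyᵇ p (Vec.toList (tabulate f)) ≡ true → ∃ λ i → p (f i) ≡ true
    over-tabulate {zero}  p f ()
    over-tabulate {suc n} p f h with p (f Fin.zero) in eq
    ... | true  = Fin.zero , eq
    ... | false = Prod.map Fin.suc (λ q → q) (over-tabulate p (f ∘ Fin.suc) h)

  anyᵇ-allFins-false : ∀ {n} (p : Fin n → Bool) → anyᵇ p (allFins n) ≡ false → ∀ i → p i ≡ false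
  anyᵇ-allFins-false p = over-tabulate p (λ i → i)
    where
    over-tabulate : ∀ {n} {A : Set} (p : A → Bool) (f : Fin n → A) →
         anyᵇ p (Vec.toList (tabulate f)) ≡ false → ∀ i → p (f i) ≡ false
    over-tabulate {suc n} p f h Fin.zero with p (f Fin.zero) | h
    ... | false | _ = refl
    over-tabulate {suc n} p f h (Fin.suc i) with p (f Fin.zero) | h
    ... | false | h' = over-tabulate p (f ∘ Fin.suc) h' i

  count-ext : ∀ {n} (p q : Fin n → Bool) → (∀ i → p i ≡ q i) → count p ≡ count q
  count-ext {zero}  p q h = refl
  count-ext {suc n} p q h rewrite h Fin.zero with q Fin.zero
  ... | true  = cong suc (count-ext (p ∘ Fin.suc) (q ∘ Fin.suc) (h ∘ Fin.suc))
  ... | false = count-ext (p ∘ Fin.suc) (q ∘ Fin.suc) (h ∘ Fin.suc)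

  count-mono : ∀ {n} (p q : Fin n → Bool) → (∀ i → p i ≡ true → q i ≡ true) → count p ≤ count q
  count-mono {zero}  p q h = z≤n
  count-mono {suc n} p q h with p Fin.zero in e₁ | q Fin.zero in e₂
  ... | true  | true  = s≤s (count-mono (p ∘ Fin.suc) (q ∘ Fin.suc) (h ∘ Fin.suc))
  ... | true  | false = ⊥-elim (true≢false (h Fin.zero e₁) e₂)
  ... | false | true  = ℕP.m≤n⇒m≤1+n (count-mono (p ∘ Fin.suc) (q ∘ Fin.suc) (h ∘ Fin.suc))
  ... | false | false = count-mono (p ∘ Fin.suc) (q ∘ Fin.suc) (h ∘ Fin.suc)

  count-∨ : ∀ {n} (p q : Fin n → Bool) → (∀ i → p i ≡ true → q i ≡ true → Empty) →
            count (λ i → p i ∨ q i) ≡ count p + count q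
  count-∨ {zero}  p q h = refl
  count-∨ {suc n} p q h with p Fin.zero in e₁ | q Fin.zero in e₂
  ... | true  | true  = ⊥-elim (h Fin.zero e₁ e₂)
  ... | true  | false = cong suc (count-∨ (p ∘ Fin.suc) (q ∘ Fin.suc) (h ∘ Fin.suc))
  ... | false | true  = trans (cong suc (count-∨ (p ∘ Fin.suc) (q ∘ Fin.suc) (h ∘ Fin.suc)))
                             (sym (ℕP.+-suc (count (p ∘ Fin.suc)) (count (q ∘ Fin.suc))))
  ... | false | false = count-∨ (p ∘ Fin.suc) (q ∘ Fin.suc) (h ∘ Fin.suc)

  count-none : ∀ {n} (p : Fin n → Bool) → (∀ i → p i ≡ false) → count p ≡ 0
  count-none {zero}  p h = refl
  count-none {suc n} p h rewrite h Fin.zero = count-none (p ∘ Fin.suc) (h ∘ Fin.suc)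

  count-single : ∀ {n} (p : Fin n → Bool) (m : Fin n) → p m ≡ true → (∀ i → p i ≡ true → i ≡ m) → count p ≡ 1
  count-single {suc n} p Fin.zero pm h rewrite pm = cong suc (count-none (p ∘ Fin.suc) others)
    where
    others : ∀ i → p (Fin.suc i) ≡ false
    others i with p (Fin.suc i) in e
    ... | true with () ← h (Fin.suc i) e
    ... | false = refl
  count-single {suc n} p (Fin.suc m) pm h with p Fin.zero in e
  ... | true with () ← h Fin.zero e
  ... | false = count-single (p ∘ Fin.suc) m pm (λ i q → FinP.suc-injective (h (Fin.suc i) q))

  count-pos : ∀ {n} (p : Fin n → Bool) i → p i ≡ true → 1 ≤ count p
  count-pos {suc n} p Fin.zero e rewrite e = s≤s z≤n
  count-pos {suc n} p (Fin.suc i) e with p Fin.zero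
  ... | true  = s≤s z≤n
  ... | false = count-pos (p ∘ Fin.suc) i e

  count-add-one : ∀ {n} (p q : Fin n → Bool) (m : Fin n) → q m ≡ true → p m ≡ false →
                  (∀ i → i ≢ m → p i ≡ q i) → count q ≡ suc (count p)
  count-add-one p q m qm pm h =
    trans (count-ext q (λ i → p i ∨ atm i) q≡p∨atm)
    (trans (count-∨ p atm disjoint)
    (trans (cong (count p +_) (count-single atm m (atm-at m refl) atm-only)) (ℕP.+-comm (count p) 1)))
    where
    atm : Fin _ → Bool
    atm i = ⌊ i FinP.≟ m ⌋
    atm-at : ∀ i → i ≡ m → atm i ≡ true
    atm-at i refl with i FinP.≟ i
    ... | yes _ = refl
    ... | no ne = ⊥-elim (ne refl)
    atm-only : ∀ i → atm i ≡ true → i ≡ m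
    atm-only i e with i FinP.≟ m
    ... | yes eq = eq
    atm-only i () | no _
    q≡p∨atm : ∀ i → q i ≡ p i ∨ atm i
    q≡p∨atm i with i FinP.≟ m
    ... | yes refl = trans qm (sym (cong (_∨ true) pm))
    ... | no ne    = trans (sym (h i ne)) (sym (∨-identityʳ (p i)))
    disjoint : ∀ i → p i ≡ true → atm i ≡ true → Empty
    disjoint i pi ai with atm-only i ai
    ... | refl = true≢false pi pm

  size≡count : ∀ {n} (S : Subset n) → sizeˢ S ≡ count (lookup S)
  size≡count []          = refl
  size≡count (true ∷ S)  = cong suc (size≡count S)
  size≡count (false ∷ S) = size≡count S

  -- Every vertex of V is connected to exactly one representative.

  module _ {n : ℕ} where

    isRepᵇ : Subset n → Edges n → Fin n → Bool
    isRepᵇ V es v = lookup V v ∧ not (anyᵇ (λ u → lookup V u ∧ (toℕ u <ᵇ toℕ v) ∧ connectedᵇ es u v) (allFins n))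

    components≡count : ∀ V es → components V es ≡ count (isRepᵇ V es)
    components≡count V es = countᵇ-allFins (isRepᵇ V es)

    IsRep : Subset n → Edges n → Fin n → Set
    IsRep V es v = v ∈ₛ V × (∀ u → u ∈ₛ V → toℕ u < toℕ v → ¬ conn es u v)

    isRepᵇ-sound : ∀ V es v → isRepᵇ V es v ≡ true → IsRep V es v
    isRepᵇ-sound V es v e with ∧-elim (lookup V v) _ e
    ... | e₁ , e₂ = mk e₁ , λ u uV lt c →
      true≢false (∧-intro (get uV) (∧-intro (<ᵇ-intro lt) (get c))) (anyᵇ-allFins-false _ (not-elim e₂) u)

    isRepᵇ-complete : ∀ V es v → IsRep V es v → isRepᵇ V es v ≡ true
    isRepᵇ-complete V es v (vV , h) = ∧-intro (get vV) (not-intro no-smaller)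
      where
      no-smaller : anyᵇ (λ u → lookup V u ∧ (toℕ u <ᵇ toℕ v) ∧ connectedᵇ es u v) (allFins n) ≡ false
      no-smaller with anyᵇ (λ u → lookup V u ∧ (toℕ u <ᵇ toℕ v) ∧ connectedᵇ es u v) (allFins n) in eq
      ... | false = refl
      ... | true with anyᵇ-allFins _ eq
      ... | u , q with ∧-elim (lookup V u) _ q
      ... | q₁ , q₂ with ∧-elim (toℕ u <ᵇ toℕ v) _ q₂
      ... | q₃ , q₄ = ⊥-elim (h u (mk q₁) (<ᵇ-elim _ _ q₃) (mk q₄))

    isRepᵇ-ext : ∀ V es es' v → (IsRep V es v → IsRep V es' v) → isRepᵇ V es v ≡ true → isRepᵇ V es' v ≡ true
    isRepᵇ-ext V es es' v f e = isRepᵇ-complete V es' v (f (isRepᵇ-sound V es v e))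

    ConnWithin : Subset n → Edges n → Edges n → Set
    ConnWithin V es es' = ∀ u w → u ∈ₛ V → w ∈ₛ V → conn es u w → conn es' u w

    components-anti : ∀ V es es' → ConnWithin V es' es → components V es ≤ components V es'
    components-anti V es es' h rewrite components≡count V es | components≡count V es' =
      count-mono _ _ λ v → isRepᵇ-ext V es es' v λ { (vV , r) → vV , λ u uV lt c → r u uV lt (h u v uV vV c) }

    components-≡ : ∀ V es es' → ConnWithin V es' es → ConnWithin V es es' → components V es ≡ components V es'
    components-≡ V es es' h₁ h₂ = ℕP.≤-antisym (components-anti V es es' h₁) (components-anti V es' es h₂)

    -- representatives are members
    components≤size : ∀ V es → components V es ≤ sizeˢ V
    components≤size V es rewrite components≡count V es | size≡count V =
      count-mono _ _ λ i e → get (proj₁ (isRepᵇ-sound V es i e))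

    components-none : ∀ C es → (∀ i → lookup C i ≡ false) → components C es ≡ 0
    components-none C es h = trans (components≡count C es) (count-none _ no-rep)
      where
      no-rep : ∀ i → isRepᵇ C es i ≡ false
      no-rep i with isRepᵇ C es i in e
      ... | false = refl
      ... | true  = ⊥-elim (true≢false (get (proj₁ (isRepᵇ-sound C es i e))) (h i))

    conn-[] : ∀ {u v} → conn [] u v → u ≡ v
    conn-[] {u} {v} c = sym (lookup-⁅⁆ u v (get (conn-closed {n} {[]} ⁅ u ⁆ (λ ()) (mk (lookup-⁅⁆-self u)) c)))

    components-[] : ∀ V → components V [] ≡ sizeˢ V
    components-[] V = trans (components≡count V []) (trans (count-ext _ _ rep≡member) (sym (size≡count V)))
      where
      rep≡member : ∀ v → isRepᵇ V [] v ≡ lookup V v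
      rep≡member v = bool-ext (λ e → get (proj₁ (isRepᵇ-sound V [] v e)))
                              (λ e → isRepᵇ-complete V [] v (mk e , λ u uV lt c → ℕP.<-irrefl (cong toℕ (conn-[] c)) lt))

    rep-exists : ∀ V es v → v ∈ₛ V → ∃ λ r → IsRep V es r × conn es r v
    rep-exists V es v vV = descend (suc (toℕ v)) v vV ℕP.≤-refl
      where
      -- descend along smaller connected vertices, bounded by k
      descend : ∀ k v → v ∈ₛ V → toℕ v < k → ∃ λ r → IsRep V es r × conn es r v
      descend (suc k) v vV (s≤s lt) with isRepᵇ V es v in eq
      ... | true  = v , isRepᵇ-sound V es v eq , conn-refl v
      ... | false = smaller _ refl
        where
        smaller : ∀ b → anyᵇ (λ u → lookup V u ∧ (toℕ u <ᵇ toℕ v) ∧ connectedᵇ es u v) (allFins n) ≡ b →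
                  ∃ λ r → IsRep V es r × conn es r v
        smaller false eq₂ = ⊥-elim (true≢false (isRepᵇ-complete V es v (vV , λ u uV ltu c →
          true≢false (∧-intro (get uV) (∧-intro (<ᵇ-intro ltu) (get c))) (anyᵇ-allFins-false _ eq₂ u))) eq)
        smaller true eq₂ with anyᵇ-allFins _ eq₂
        ... | u , q with ∧-elim (lookup V u) _ q
        ... | q₁ , q₂ with ∧-elim (toℕ u <ᵇ toℕ v) _ q₂
        ... | q₃ , q₄ with descend k u (mk q₁) (ℕP.≤-trans (<ᵇ-elim _ _ q₃) lt)
        ... | r , isRep , c = r , isRep , conn-trans c (mk q₄)

    rep-unique : ∀ V es r₁ r₂ → IsRep V es r₁ → IsRep V es r₂ → conn es r₁ r₂ → r₁ ≡ r₂
    rep-unique V es r₁ r₂ (m₁ , h₁) (m₂ , h₂) c with FinP.<-cmp r₁ r₂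
    ... | tri< lt _ _  = ⊥-elim (h₂ r₁ m₁ lt c)
    ... | tri≈ _ eq _  = eq
    ... | tri> _ _ gt = ⊥-elim (h₁ r₂ m₂ gt (conn-sym c))

    components-one : ∀ C es v → v ∈ₛ C → (∀ u w → u ∈ₛ C → w ∈ₛ C → conn es u w) → components C es ≡ 1
    components-one C es v vC connected with rep-exists C es v vC
    ... | r , isRep , _ = trans (components≡count C es)
      (count-single _ r (isRepᵇ-complete C es r isRep) λ i e →
        rep-unique C es i r (isRepᵇ-sound C es i e) isRep (connected i r (proj₁ (isRepᵇ-sound C es i e)) (proj₁ isRep)))

    components≥1 : ∀ V es v → v ∈ₛ V → 1 ≤ components V es
    components≥1 V es v vV with rep-exists V es v vV
    ... | r , isRep , _ rewrite components≡count V es = count-pos _ r (isRepᵇ-complete V es r isRep)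

  -- A walk in ab ∷ es either avoids the new edge or
  -- uses it once; so a redundant edge (a, b already connected) changes no
  -- component, while an edge between two components merges them into one.

  module _ {n : ℕ} where

    conn-∷ : ∀ {a b es u v} → conn {n} ((a , b) ∷ es) u v →
             conn es u v ⊎ (conn es u a × conn es b v) ⊎ (conn es u b × conn es a v)
    conn-∷ {a} {b} {es} {u} {v} c = fromX v (conn-closed X closedX (toX u (inj₁ (conn-refl u))) c)
      where
      P : Fin n → Set
      P w = conn es u w ⊎ (conn es u a × conn es b w) ⊎ (conn es u b × conn es a w)
      cb : Fin n → Fin n → Bool
      cb = connectedᵇ es
      X : Subset n
      X = tabulate (λ w → cb u w ∨ (cb u a ∧ cb b w) ∨ (cb u b ∧ cb a w))
      fromX : ∀ w → w ∈ₛ X → P w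
      fromX w (mk e) with ∨-elim (cb u w) _ (trans (sym (lookup∘tabulate _ w)) e)
      ... | inj₁ e₁ = inj₁ (mk e₁)
      ... | inj₂ e₂ with ∨-elim (cb u a ∧ cb b w) _ e₂
      ... | inj₁ e₃ = inj₂ (inj₁ (Prod.map mk mk (∧-elim _ _ e₃)))
      ... | inj₂ e₄ = inj₂ (inj₂ (Prod.map mk mk (∧-elim _ _ e₄)))
      toX : ∀ w → P w → w ∈ₛ X
      toX w p = mk (trans (lookup∘tabulate _ w) (holds p))
        where
        holds : P w → (cb u w ∨ (cb u a ∧ cb b w) ∨ (cb u b ∧ cb a w)) ≡ true
        holds (inj₁ (mk e)) = ∨-introˡ _ _ e
        holds (inj₂ (inj₁ (mk e₁ , mk e₂))) = ∨-introʳ (cb u w) _ (∨-introˡ _ _ (∧-intro e₁ e₂))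
        holds (inj₂ (inj₂ (mk e₁ , mk e₂))) = ∨-introʳ (cb u w) _ (∨-introʳ (cb u a ∧ cb b w) _ (∧-intro e₁ e₂))
      along : ∀ {x y} → conn es x y → P x → P y
      along c (inj₁ p)              = inj₁ (conn-trans p c)
      along c (inj₂ (inj₁ (p , q))) = inj₂ (inj₁ (p , conn-trans q c))
      along c (inj₂ (inj₂ (p , q))) = inj₂ (inj₂ (p , conn-trans q c))
      across : P a → P b
      across (inj₁ p)              = inj₂ (inj₁ (p , conn-refl b))
      across (inj₂ (inj₁ (p , _))) = inj₂ (inj₁ (p , conn-refl b))
      across (inj₂ (inj₂ (p , _))) = inj₁ p
      back : P b → P a
      back (inj₁ p)              = inj₂ (inj₂ (p , conn-refl a))
      back (inj₂ (inj₁ (p , _))) = inj₁ p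
      back (inj₂ (inj₂ (p , _))) = inj₂ (inj₂ (p , conn-refl a))
      closedX : Closed ((a , b) ∷ es) X
      closedX (here refl) = (λ xa → toX b (across (fromX a xa))) , (λ xb → toX a (back (fromX b xb)))
      closedX (there m)   = (λ xa → toX _ (along (conn-edge m) (fromX _ xa))) ,
                            (λ xb → toX _ (along (conn-edge' m) (fromX _ xb)))

    conn-∷-redundant : ∀ {a b es u v} → conn {n} es a b → conn ((a , b) ∷ es) u v → conn es u v
    conn-∷-redundant cab c with conn-∷ c
    ... | inj₁ p              = p
    ... | inj₂ (inj₁ (p , q)) = conn-trans p (conn-trans cab q)
    ... | inj₂ (inj₂ (p , q)) = conn-trans p (conn-trans (conn-sym cab) q)

    conn-there : ∀ {e es u v} → conn {n} es u v → conn (e ∷ es) u v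
    conn-there = conn-mono there

    components-redundant : ∀ V a b es → conn es a b → components V ((a , b) ∷ es) ≡ components V es
    components-redundant V a b es cab =
      components-≡ V _ _ (λ u w _ _ → conn-there) (λ u w _ _ → conn-∷-redundant cab)

    components-lose-one : ∀ V es es' (o m : Fin n) → IsRep V es m → toℕ o < toℕ m → o ∈ₛ V → conn es' o m →
      (∀ {u w} → conn es u w → conn es' u w) →
      (∀ u v → u ∈ₛ V → IsRep V es v → toℕ u < toℕ v → conn es' u v → conn es u v ⊎ v ≡ m) →
      components V es ≡ suc (components V es')
    components-lose-one V es es' o m isRep-m o<m oV o~m mono new-links =
      trans (components≡count V es)
      (trans (count-add-one (isRepᵇ V es') (isRepᵇ V es) m (isRepᵇ-complete V es m isRep-m) m-lost same-elsewhere)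
             (cong suc (sym (components≡count V es'))))
      where
      m-lost : isRepᵇ V es' m ≡ false
      m-lost with isRepᵇ V es' m in eq
      ... | false = refl
      ... | true  = ⊥-elim (proj₂ (isRepᵇ-sound V es' m eq) o oV o<m o~m)
      same-elsewhere : ∀ v → v ≢ m → isRepᵇ V es' v ≡ isRepᵇ V es v
      same-elsewhere v v≢m = bool-ext
        (isRepᵇ-ext V es' es v λ { (vV , r) → vV , λ u uV lt c → r u uV lt (mono c) })
        (isRepᵇ-ext V es es' v λ { (vV , r) → vV , λ u uV lt c →
           [ r u uV lt , v≢m ] (new-links u v uV (vV , r) lt c) })

    -- an edge between different components merges them: the larger of the
    -- two representatives ra, rb stops being one
    components-merge : ∀ V a b es → a ∈ₛ V → b ∈ₛ V → ¬ conn es a b →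
                       components V es ≡ suc (components V ((a , b) ∷ es))
    components-merge V a b es aV bV a≁b
      with rep-exists V es a aV | rep-exists V es b bV
    ... | ra , Ra , ra~a | rb , Rb , rb~b = by-order (FinP.<-cmp ra rb)
      where
      es' = (a , b) ∷ es
      ra≢rb : ra ≢ rb
      ra≢rb refl = a≁b (conn-trans (conn-sym ra~a) rb~b)
      ra~rb : conn es' ra rb
      ra~rb = conn-trans (conn-there ra~a) (conn-trans (conn-edge (here refl)) (conn-there (conn-sym rb~b)))
      minimal : ∀ {u r x} → u ∈ₛ V → IsRep V es r → conn es r x → conn es u x → toℕ r ≤ toℕ u
      minimal uV (_ , hr) r~x u~x = ℕP.≮⇒≥ λ lt → hr _ uV lt (conn-trans u~x (conn-sym r~x))
      new-links : ∀ u v → u ∈ₛ V → IsRep V es v → toℕ u < toℕ v → conn es' u v →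
                  conn es u v ⊎ (v ≡ rb × toℕ ra < toℕ rb) ⊎ (v ≡ ra × toℕ rb < toℕ ra)
      new-links u v uV Rv lt c with conn-∷ c
      ... | inj₁ p = inj₁ p
      ... | inj₂ (inj₁ (u~a , b~v)) with rep-unique V es rb v Rb Rv (conn-trans rb~b b~v)
      ... | refl = inj₂ (inj₁ (refl , ℕP.≤-<-trans (minimal uV Ra ra~a u~a) lt))
      new-links u v uV Rv lt c | inj₂ (inj₂ (u~b , a~v)) with rep-unique V es ra v Ra Rv (conn-trans ra~a a~v)
      ... | refl = inj₂ (inj₂ (refl , ℕP.≤-<-trans (minimal uV Rb rb~b u~b) lt))
      by-order : Tri (toℕ ra < toℕ rb) (ra ≡ rb) (toℕ rb < toℕ ra) →
                 components V es ≡ suc (components V es')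
      by-order (tri≈ _ eq _) = ⊥-elim (ra≢rb eq)
      by-order (tri< lt _ _) = components-lose-one V es es' ra rb Rb lt (proj₁ Ra) ra~rb conn-there
        (λ u v uV Rv ltv c → Sum.map₂ [ proj₁ , (λ q → ⊥-elim (ℕP.<-asym lt (proj₂ q))) ] (new-links u v uV Rv ltv c))
      by-order (tri> _ _ gt) = components-lose-one V es es' rb ra Ra gt (proj₁ Rb) (conn-sym ra~rb) conn-there
        (λ u v uV Rv ltv c → Sum.map₂ [ (λ q → ⊥-elim (ℕP.<-asym gt (proj₂ q))) , proj₁ ] (new-links u v uV Rv ltv c))

  components-∪ : ∀ {n} (X Y : Subset n) es → (∀ i → i ∈ₛ X → i ∈ₛ Y → Empty) →
                 (∀ u v → u ∈ₛ X → v ∈ₛ Y → conn es u v → Empty) →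
                 components (X ∪ Y) es ≡ components X es + components Y es
  components-∪ X Y es disjoint separated =
    trans (components≡count (X ∪ Y) es) (trans (count-ext _ _ rep-∪)
    (trans (count-∨ (isRepᵇ X es) (isRepᵇ Y es) λ i e₁ e₂ → disjoint i (proj₁ (isRepᵇ-sound X es i e₁)) (proj₁ (isRepᵇ-sound Y es i e₂)))
           (sym (cong₂ _+_ (components≡count X es) (components≡count Y es)))))
    where
    ∪-elim : ∀ i → i ∈ₛ (X ∪ Y) → i ∈ₛ X ⊎ i ∈ₛ Y
    ∪-elim i (mk e) = Sum.map mk mk (∨-elim _ _ (trans (sym (lookup-∪ X Y i)) e))
    ∪-introˡ : ∀ i → i ∈ₛ X → i ∈ₛ (X ∪ Y)
    ∪-introˡ i (mk e) = mk (trans (lookup-∪ X Y i) (∨-introˡ _ _ e))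
    ∪-introʳ : ∀ i → i ∈ₛ Y → i ∈ₛ (X ∪ Y)
    ∪-introʳ i (mk e) = mk (trans (lookup-∪ X Y i) (∨-introʳ (lookup X i) _ e))
    -- a representative of X is one of X ∪ Y, since nothing in Y is connected to it
    rep-X : ∀ v → IsRep X es v → IsRep (X ∪ Y) es v
    rep-X v (vX , h) = ∪-introˡ v vX , λ u uXY lt c → [ (λ uX → h u uX lt c) , (λ uY → separated v u vX uY (conn-sym c)) ] (∪-elim u uXY)
    rep-Y : ∀ v → IsRep Y es v → IsRep (X ∪ Y) es v
    rep-Y v (vY , h) = ∪-introʳ v vY , λ u uXY lt c → [ (λ uX → separated u v uX vY c) , (λ uY → h u uY lt c) ] (∪-elim u uXY)
    rep-∪ : ∀ v → isRepᵇ (X ∪ Y) es v ≡ isRepᵇ X es v ∨ isRepᵇ Y es v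
    rep-∪ v = bool-ext to from
      where
      to : isRepᵇ (X ∪ Y) es v ≡ true → (isRepᵇ X es v ∨ isRepᵇ Y es v) ≡ true
      to e with isRepᵇ-sound (X ∪ Y) es v e
      ... | vXY , h with ∪-elim v vXY
      ... | inj₁ vX = ∨-introˡ _ _ (isRepᵇ-complete X es v (vX , λ u uX → h u (∪-introˡ u uX)))
      ... | inj₂ vY = ∨-introʳ (isRepᵇ X es v) _ (isRepᵇ-complete Y es v (vY , λ u uY → h u (∪-introʳ u uY)))
      from : (isRepᵇ X es v ∨ isRepᵇ Y es v) ≡ true → isRepᵇ (X ∪ Y) es v ≡ true
      from e with ∨-elim _ _ e
      ... | inj₁ e₁ = isRepᵇ-complete (X ∪ Y) es v (rep-X v (isRepᵇ-sound X es v e₁))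
      ... | inj₂ e₂ = isRepᵇ-complete (X ∪ Y) es v (rep-Y v (isRepᵇ-sound Y es v e₂))

  allᵇ-intro : ∀ {A : Set} (p : A → Bool) xs → (∀ x → x ∈ xs → p x ≡ true) → allᵇ p xs ≡ true
  allᵇ-intro p []       h = refl
  allᵇ-intro p (x ∷ xs) h = ∧-intro (h x (here refl)) (allᵇ-intro p xs (λ y m → h y (there m)))

  allᵇ-elim : ∀ {A : Set} (p : A → Bool) xs → allᵇ p xs ≡ true → ∀ x → x ∈ xs → p x ≡ true
  allᵇ-elim p (y ∷ xs) e x (here refl) = proj₁ (∧-elim _ _ e)
  allᵇ-elim p (y ∷ xs) e x (there m)   = allᵇ-elim p xs (proj₂ (∧-elim (p y) _ e)) x m

  allᵇ-cong : ∀ {A : Set} {p q : A → Bool} xs → (∀ x → x ∈ xs → p x ≡ q x) → allᵇ p xs ≡ allᵇ q xs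
  allᵇ-cong []       h = refl
  allᵇ-cong (x ∷ xs) h = cong₂ _∧_ (h x (here refl)) (allᵇ-cong xs (λ y m → h y (there m)))

  allᵇ-∧ : ∀ {A : Set} {p q r : A → Bool} xs → (∀ x → x ∈ xs → p x ≡ q x ∧ r x) →
           allᵇ p xs ≡ allᵇ q xs ∧ allᵇ r xs
  allᵇ-∧ []       h = refl
  allᵇ-∧ {q = q} {r} (x ∷ xs) h rewrite h x (here refl) | allᵇ-∧ xs (λ y m → h y (there m)) =
    interchange (q x) (r x) (allᵇ q xs) (allᵇ r xs)
    where
    interchange : ∀ a b c d → (a ∧ b) ∧ (c ∧ d) ≡ (a ∧ c) ∧ (b ∧ d)
    interchange true  true  c d = refl
    interchange true  false c d = sym (∧-zeroʳ c)
    interchange false b     c d = refl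

  filterᵇ-∈ : ∀ {A : Set} (p : A → Bool) {x} xs → x ∈ xs → p x ≡ true → x ∈ filterᵇ p xs
  filterᵇ-∈ p (y ∷ xs) (here refl) e rewrite e = here refl
  filterᵇ-∈ p (y ∷ xs) (there m) e with p y
  ... | true  = there (filterᵇ-∈ p xs m e)
  ... | false = filterᵇ-∈ p xs m e

  filterᵇ-∈⁻ : ∀ {A : Set} (p : A → Bool) {x} xs → x ∈ filterᵇ p xs → x ∈ xs × p x ≡ true
  filterᵇ-∈⁻ p (y ∷ xs) m with p y in e
  filterᵇ-∈⁻ p (y ∷ xs) (here refl) | true = here refl , e
  filterᵇ-∈⁻ p (y ∷ xs) (there m)   | true = Prod.map₁ there (filterᵇ-∈⁻ p xs m)
  filterᵇ-∈⁻ p (y ∷ xs) m           | false = Prod.map₁ there (filterᵇ-∈⁻ p xs m)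

  filterᵇ-none : ∀ {A : Set} (p : A → Bool) xs → (∀ x → p x ≡ false) → filterᵇ p xs ≡ []
  filterᵇ-none p []       h = refl
  filterᵇ-none p (x ∷ xs) h rewrite h x = filterᵇ-none p xs h

  filterᵇ-∷-true : ∀ {A : Set} (p : A → Bool) {x} xs → p x ≡ true → filterᵇ p (x ∷ xs) ≡ x ∷ filterᵇ p xs
  filterᵇ-∷-true p xs e rewrite e = refl

  filterᵇ-∷-false : ∀ {A : Set} (p : A → Bool) {x} xs → p x ≡ false → filterᵇ p (x ∷ xs) ≡ filterᵇ p xs
  filterᵇ-∷-false p xs e rewrite e = refl

  filterᵇ-absorb : ∀ {A : Set} (p r : A → Bool) xs → (∀ x → p x ≡ true → r x ≡ true) →
                   filterᵇ p (filterᵇ r xs) ≡ filterᵇ p xs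
  filterᵇ-absorb p r []       h = refl
  filterᵇ-absorb p r (x ∷ xs) h with r x in er | p x in ep
  ... | true  | true  rewrite ep = cong (x ∷_) (filterᵇ-absorb p r xs h)
  ... | true  | false rewrite ep = filterᵇ-absorb p r xs h
  ... | false | true  = ⊥-elim (true≢false (h x ep) er)
  ... | false | false = filterᵇ-absorb p r xs h

  maxℕ-ub : ∀ xs {x} → x ∈ xs → x ≤ maxℕ xs
  maxℕ-ub (y ∷ xs) (here refl) = ℕP.m≤m⊔n y (maxℕ xs)
  maxℕ-ub (y ∷ xs) (there m)   = ℕP.≤-trans (maxℕ-ub xs m) (ℕP.m≤n⊔m y (maxℕ xs))

  maxℕ-lub : ∀ xs m → (∀ x → x ∈ xs → x ≤ m) → maxℕ xs ≤ m
  maxℕ-lub []       m h = z≤n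
  maxℕ-lub (y ∷ xs) m h = ℕP.⊔-lub (h y (here refl)) (maxℕ-lub xs m (λ x q → h x (there q)))

  maxℕ-≡ : ∀ xs m → (∀ x → x ∈ xs → x ≤ m) → m ∈ xs → maxℕ xs ≡ m
  maxℕ-≡ xs m h mem = ℕP.≤-antisym (maxℕ-lub xs m h) (maxℕ-ub xs mem)

  sublists-⊆ : ∀ {A : Set} (xs : List A) {ys} → ys ∈ sublists xs → ∀ {e} → e ∈ ys → e ∈ xs
  sublists-⊆ [] (here refl) ()
  sublists-⊆ (x ∷ xs) {ys} m em with ∈-++⁻ (map (x ∷_) (sublists xs)) m
  ... | inj₂ m₂ = there (sublists-⊆ xs m₂ em)
  ... | inj₁ m₁ with ∈-map⁻ (x ∷_) m₁
  ... | zs , zm , refl with em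
  ... | here refl = here refl
  ... | there em' = there (sublists-⊆ xs zm em')

  sublists-length : ∀ {A : Set} (xs : List A) {ys} → ys ∈ sublists xs → length ys ≤ length xs
  sublists-length []       (here refl) = z≤n
  sublists-length (x ∷ xs) {ys} m with ∈-++⁻ (map (x ∷_) (sublists xs)) m
  ... | inj₂ m₂ = ℕP.m≤n⇒m≤1+n (sublists-length xs m₂)
  ... | inj₁ m₁ with ∈-map⁻ (x ∷_) m₁
  ... | zs , zm , refl = s≤s (sublists-length xs zm)

  picks-spec : ∀ {A : Set} (xs : List A) {e rest} → (e , rest) ∈ picks xs →
    (∀ {x} → x ∈ xs → x ≡ e ⊎ x ∈ rest) × (∀ {x} → x ∈ rest → x ∈ xs) × e ∈ xs × length xs ≡ suc (length rest)
  picks-spec (x ∷ xs) (here refl) = (λ { (here refl) → inj₁ refl ; (there m) → inj₂ m }) , there , here refl , refl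
  picks-spec (x ∷ xs) (there m) with ∈-map⁻ (λ p → proj₁ p , x ∷ proj₂ p) m
  ... | (e' , rest') , m' , refl with picks-spec xs m'
  ... | split , sub , e∈ , len =
    (λ { (here refl) → inj₂ (here refl) ; (there q) → Sum.map₂ there (split q) }) ,
    (λ { (here refl) → here refl ; (there q) → there (sub q) }) , there e∈ , cong suc len

  -- Each edge lowers the number of components by at most one, by exactly
  -- one iff it joins two components; so acyclic sets B are exactly those
  -- with c(S,B) + |B| = |S|, and a greedily built spanning forest of A is an
  -- acyclic subset of maximum size.

  module _ {n : ℕ} where

    Inside : Subset n → Edges n → Set
    Inside S A = ∀ {a b} → (a , b) ∈ A → a ∈ₛ S × b ∈ₛ S

    Inside-sub : ∀ {S A B} → (∀ {e} → e ∈ B → e ∈ A) → Inside S A → Inside S B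
    Inside-sub sub h m = h (sub m)

    size≤components+length : ∀ S B → Inside S B → sizeˢ S ≤ components S B + length B
    size≤components+length S [] h = ℕP.≤-reflexive (trans (sym (components-[] S)) (sym (ℕP.+-identityʳ _)))
    size≤components+length S ((a , b) ∷ B) h with connectedᵇ B a b in eq
    ... | true  = ℕP.≤-trans (size≤components+length S B (h ∘ there))
        (ℕP.≤-trans (ℕP.≤-reflexive (cong (_+ length B) (sym (components-redundant S a b B (mk eq)))))
                    (ℕP.+-monoʳ-≤ (components S ((a , b) ∷ B)) (ℕP.n≤1+n _)))
    ... | false = ℕP.≤-trans (size≤components+length S B (h ∘ there))
        (ℕP.≤-reflexive (trans (cong (_+ length B)
          (components-merge S a b B (proj₁ (h (here refl))) (proj₂ (h (here refl))) (λ c → true≢false (get c) eq)))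
                               (sym (ℕP.+-suc _ _))))

    acyclic-∷ : ∀ a b (B : Edges n) → acyclicᵇ ((a , b) ∷ B) ≡ true → (¬ conn B a b) × acyclicᵇ B ≡ true
    acyclic-∷ a b B e with ∧-elim (not (connectedᵇ B a b)) _ e
    ... | e₁ , e₂ = (λ c → true≢false (get c) (not-elim e₁)) ,
       allᵇ-intro _ (picks B) (λ { ((x , y) , rest) m →
          not-intro (drop-head x y rest (not-elim (allᵇ-elim _ _ e₂ _ (∈-map⁺ (λ p → proj₁ p , (a , b) ∷ proj₂ p) m)))) })
      where
      drop-head : ∀ x y rest → connectedᵇ ((a , b) ∷ rest) x y ≡ false → connectedᵇ rest x y ≡ false
      drop-head x y rest f with connectedᵇ rest x y in q
      ... | false = refl
      ... | true  = ⊥-elim (true≢false (get (conn-there {e = a , b} (mk q))) f)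

    acyclic⇒forest : ∀ S B → acyclicᵇ B ≡ true → Inside S B → components S B + length B ≡ sizeˢ S
    acyclic⇒forest S [] e h = trans (ℕP.+-identityʳ _) (components-[] S)
    acyclic⇒forest S ((a , b) ∷ B) e h with acyclic-∷ a b B e
    ... | a≁b , acyclicB =
      trans (ℕP.+-suc _ _) (trans (cong (_+ length B) (sym (components-merge S a b B (proj₁ (h (here refl)))
                  (proj₂ (h (here refl))) a≁b))) (acyclic⇒forest S B acyclicB (h ∘ there)))

    -- Conversely, if some edge ab of B were on a cycle, removing it would keep
    -- the components and |S| ≤ c + |B| - 1 would contradict the count.
    forest⇒acyclic : ∀ S B → Inside S B → components S B + length B ≡ sizeˢ S → acyclicᵇ B ≡ true
    forest⇒acyclic S B h eq = allᵇ-intro _ (picks B) λ { ((a , b) , rest) m → not-intro (no-cycle a b rest m) }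
      where
      no-cycle : ∀ a b rest → ((a , b) , rest) ∈ picks B → connectedᵇ rest a b ≡ false
      no-cycle a b rest m with connectedᵇ rest a b in q
      ... | false = refl
      ... | true with picks-spec B m
      ... | split , sub , ab∈ , len = ⊥-elim (ℕP.<-irrefl refl (ℕP.<-≤-trans too-big (ℕP.≤-reflexive eq)))
        where
        same-components : components S B ≡ components S rest
        same-components = trans
          (components-≡ S B ((a , b) ∷ rest)
            (λ u w _ _ → conn-mono λ { (here refl) → ab∈ ; (there z) → sub z })
            (λ u w _ _ → conn-mono λ xm → [ (λ { refl → here refl }) , there ] (split xm)))
          (components-redundant S a b rest (mk q))
        too-big : sizeˢ S < components S B + length B
        too-big rewrite same-components | len =
          ℕP.≤-trans (s≤s (size≤components+length S rest (h ∘ sub))) (ℕP.≤-reflexive (sym (ℕP.+-suc _ _)))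

    spanning-forest : ∀ S A → Inside S A → ∃ λ B → B ∈ sublists A × (∀ {u v} → conn A u v → conn B u v) ×
                      (∀ {e} → e ∈ B → e ∈ A) × components S B + length B ≡ sizeˢ S
    spanning-forest S [] h = [] , here refl , (λ c → c) , (λ ()) , trans (ℕP.+-identityʳ _) (components-[] S)
    spanning-forest S ((a , b) ∷ A) h with spanning-forest S A (h ∘ there)
    ... | B , B∈ , A⇒B , B⊆A , forestB with connectedᵇ A a b in q
    ... | true  = B , ∈-++⁺ʳ (map ((a , b) ∷_) (sublists A)) B∈ ,
                  (λ c → A⇒B (conn-∷-redundant (mk q) c)) , there ∘ B⊆A , forestB
    ... | false = ((a , b) ∷ B) , ∈-++⁺ˡ (∈-map⁺ ((a , b) ∷_) B∈) , keeps-conn ,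
                  (λ { (here refl) → here refl ; (there m) → there (B⊆A m) }) ,
                  trans (ℕP.+-suc _ _) (trans (cong (_+ length B) (sym (components-merge S a b B (proj₁ (h (here refl)))
                     (proj₂ (h (here refl))) a≁b))) forestB)
      where
      a≁b : ¬ conn B a b
      a≁b c = true≢false (get (conn-mono B⊆A c)) q
      keeps-conn : ∀ {u v} → conn ((a , b) ∷ A) u v → conn ((a , b) ∷ B) u v
      keeps-conn = conn-transfer λ X cX → λ
        { (here refl) → cX (here refl)
        ; (there m) → (λ xa → conn-closed X (Closed-sub X there cX) xa (A⇒B (conn-edge m))) ,
                      (λ xb → conn-closed X (Closed-sub X there cX) xb (A⇒B (conn-edge' m))) }

    -- the rank is attained by the spanning forest: rk A = |S| - c(S,A)
    rank-formula : ∀ S A → Inside S A → rk A + components S A ≡ sizeˢ S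
    rank-formula S A h with spanning-forest S A h
    ... | B , B∈ , A⇒B , B⊆A , forestB = trans (cong (_+ components S A) rk≡) (ℕP.m∸n+n≡m (components≤size S A))
      where
      cB≡cA : components S B ≡ components S A
      cB≡cA = components-≡ S B A (λ u w _ _ → A⇒B) (λ u w _ _ → conn-mono B⊆A)
      lengthB : length B ≡ sizeˢ S ∸ components S A
      lengthB = trans (sym (ℕP.m+n∸m≡n (components S B) (length B)))
                      (trans (cong (_∸ components S B) forestB) (cong (sizeˢ S ∸_) cB≡cA))
      -- an acyclic C ⊆ A has |C| = |S| - c(S,C) ≤ |S| - c(S,A)
      bound : ∀ x → x ∈ map length (filterᵇ acyclicᵇ (sublists A)) → x ≤ sizeˢ S ∸ components S A
      bound x xm with ∈-map⁻ length xm
      ... | C , C∈ , refl with filterᵇ-∈⁻ acyclicᵇ (sublists A) C∈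
      ... | C⊆ , acyclicC =
        ℕP.≤-trans (ℕP.≤-reflexive (sym (ℕP.m+n∸m≡n (components S C) (length C))))
        (ℕP.≤-trans (ℕP.≤-reflexive (cong (_∸ components S C) (acyclic⇒forest S C acyclicC (Inside-sub (sublists-⊆ A C⊆) h))))
                    (ℕP.∸-monoʳ-≤ (sizeˢ S) (components-anti S A C (λ u w _ _ → conn-mono (sublists-⊆ A C⊆)))))
      rk≡ : rk A ≡ sizeˢ S ∸ components S A
      rk≡ = maxℕ-≡ _ _ bound (subst (_∈ map length (filterᵇ acyclicᵇ (sublists A))) lengthB
              (∈-map⁺ length (filterᵇ-∈ acyclicᵇ (sublists A) B∈ (forest⇒acyclic S B (Inside-sub B⊆A h) forestB))))

    rank-drop : ∀ S (A E : Edges n) → Inside S E → (∀ {e} → e ∈ A → e ∈ E) →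
                (components S E + (rk E ∸ rk A) ≡ components S A) × (rk A + (rk E ∸ rk A) ≡ rk E)
    rank-drop S A E E-inside A⊆E = cE+d≡cA , rA+d≡rE
      where
      rA = rk A
      rE = rk E
      cA = components S A
      cE = components S E
      both : rA + cA ≡ rE + cE
      both = trans (rank-formula S A (Inside-sub A⊆E E-inside)) (sym (rank-formula S E E-inside))
      rA≤rE : rA ≤ rE
      rA≤rE = ℕP.+-cancelʳ-≤ cE rA rE
                (ℕP.≤-trans (ℕP.+-monoʳ-≤ rA (components-anti S E A (λ u w _ _ → conn-mono A⊆E))) (ℕP.≤-reflexive both))
      rA+d≡rE : rA + (rE ∸ rA) ≡ rE
      rA+d≡rE = ℕP.m+[n∸m]≡n rA≤rE
      cE+d≡cA : cE + (rE ∸ rA) ≡ cA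
      cE+d≡cA = ℕP.+-cancelˡ-≡ rA _ _ (begin
        rA + (cE + (rE ∸ rA))   ≡⟨ cong (rA +_) (ℕP.+-comm cE _) ⟩
        rA + ((rE ∸ rA) + cE)   ≡⟨ sym (ℕP.+-assoc rA _ cE) ⟩
        (rA + (rE ∸ rA)) + cE   ≡⟨ cong (_+ cE) rA+d≡rE ⟩
        rE + cE                 ≡⟨ sym both ⟩
        rA + cA                 ∎)
        where open ≡-Reasoning

    -- the rank of A is at most its size, so nul A = |A| - rk A loses nothing
    rk≤length : ∀ (A : Edges n) → rk A ≤ length A
    rk≤length A = maxℕ-lub _ _ λ x xm → bound x xm
      where
      bound : ∀ x → x ∈ map length (filterᵇ acyclicᵇ (sublists A)) → x ≤ length A
      bound x xm with ∈-map⁻ length xm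
      ... | C , C∈ , refl = sublists-length A (proj₁ (filterᵇ-∈⁻ acyclicᵇ (sublists A) C∈))

  edgeIn : ∀ {n} → Subset n → Fin n × Fin n → Bool
  edgeIn X e = lookup X (proj₁ e) ∧ lookup X (proj₂ e)

  split-edge : ∀ {n} (S T : Subset n) a b → lookup S a ≡ true → lookup S b ≡ true →
               edgeIn T (a , b) ∨ edgeIn (S ─ T) (a , b) ≡ (lookup T a ==ᵇ lookup T b)
  split-edge S T a b Sa Sb rewrite lookup-─ S T a | lookup-─ S T b | Sa | Sb with lookup T a | lookup T b
  ... | true  | true  = refl
  ... | true  | false = refl
  ... | false | true  = refl
  ... | false | false = refl

  length-partition : ∀ {X : Set} (p q : X → Bool) xs → (∀ e → e ∈ xs → p e ∨ q e ≡ true) →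
                     (∀ e → e ∈ xs → p e ∧ q e ≡ false) →
                     length xs ≡ length (filterᵇ p xs) + length (filterᵇ q xs)
  length-partition p q [] _ _ = refl
  length-partition p q (x ∷ xs) cover disj with p x | q x | cover x (here refl) | disj x (here refl)
  ... | true  | false | _ | _ = cong suc (length-partition p q xs (λ e → cover e ∘ there) (λ e → disj e ∘ there))
  ... | false | true  | _ | _ = trans (cong suc (length-partition p q xs (λ e → cover e ∘ there) (λ e → disj e ∘ there)))
                                      (sym (ℕP.+-suc _ _))

  ∸-+-distrib : ∀ l₁ l₂ r₁ r₂ → r₁ ≤ l₁ → r₂ ≤ l₂ → (l₁ + l₂) ∸ (r₁ + r₂) ≡ (l₁ ∸ r₁) + (l₂ ∸ r₂)
  ∸-+-distrib l₁ l₂ r₁ r₂ h₁ h₂ =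
    trans (sym (ℕP.∸-+-assoc (l₁ + l₂) r₁ r₂))
    (trans (cong (_∸ r₂) (ℕP.+-∸-comm l₂ h₁)) (ℕP.+-∸-assoc (l₁ ∸ r₁) h₂))

  module _ {n : ℕ} where

    components-restrict : ∀ (P : Fin n × Fin n → Bool) (T : Subset n) (A : Edges n) →
      (∀ {a b} → (a , b) ∈ A → P (a , b) ≡ true → lookup T a ≡ true × lookup T b ≡ true) →
      (∀ {a b} → (a , b) ∈ A → P (a , b) ≡ false → lookup T a ≡ false × lookup T b ≡ false) →
      components T (filterᵇ P A) ≡ components T A
    components-restrict P T A kept dropped =
      components-≡ T _ A restricted-conn (λ u w _ _ → conn-mono (λ m → proj₁ (filterᵇ-∈⁻ P A m)))
      where
      A' = filterᵇ P A
      -- vertices reached inside A', together with everything outside T, form an A-closed set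
      restricted-conn : ConnWithin T A A'
      restricted-conn u w uT wT c = from-X (conn-closed X closedX (mk (∈-R u (conn-refl u))) c)
        where
        X : Subset n
        X = reachWithin n A' u ∪ ∁ T
        lookup-X : ∀ z → lookup X z ≡ lookup (reachWithin n A' u) z ∨ not (lookup T z)
        lookup-X z = trans (lookup-∪ (reachWithin n A' u) (∁ T) z) (cong (lookup (reachWithin n A' u) z ∨_) (lookup-∁ T z))
        ∈-R : ∀ z → z ∈ₛ reachWithin n A' u → lookup X z ≡ true
        ∈-R z (mk e) = trans (lookup-X z) (∨-introˡ _ _ e)
        ∉-T : ∀ z → lookup T z ≡ false → z ∈ₛ X
        ∉-T z e = mk (trans (lookup-X z) (∨-introʳ (lookup (reachWithin n A' u) z) _ (not-intro e)))
        R-in-T : ∀ z → z ∈ₛ X → lookup T z ≡ true → conn A' u z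
        R-in-T z (mk e) tz with ∨-elim _ _ (trans (sym (lookup-X z)) e)
        ... | inj₁ e₁ = mk e₁
        ... | inj₂ e₂ = ⊥-elim (true≢false tz (not-elim e₂))
        from-X : w ∈ₛ X → conn A' u w
        from-X wX = R-in-T w wX (get wT)
        closedX : Closed A X
        closedX {a} {b} m with P (a , b) in pe
        ... | true  = (λ xa → mk (∈-R b (proj₁ (reach-closed A' u m') (R-in-T a xa (proj₁ (kept m pe)))))) ,
                      (λ xb → mk (∈-R a (proj₂ (reach-closed A' u m') (R-in-T b xb (proj₂ (kept m pe))))))
          where m' = filterᵇ-∈ P A m pe
        ... | false = (λ _ → ∉-T b (proj₂ (dropped m pe))) , (λ _ → ∉-T a (proj₁ (dropped m pe)))

    module Split (S T : Subset n) (A : Edges n) (T⊆S : T ⊆ S) (A-inside : Inside S A)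
                 (splits : ∀ {a b} → (a , b) ∈ A → edgeIn T (a , b) ∨ edgeIn (S ─ T) (a , b) ≡ true) where

      U = S ─ T
      A₁ = filterᵇ (edgeIn T) A
      A₂ = filterᵇ (edgeIn U) A

      private
        U∌T : ∀ i → lookup U i ≡ true → lookup T i ≡ false
        U∌T i e = proj₂ (─-member S T i e)

        T∌U : ∀ i → lookup T i ≡ true → lookup U i ≡ false
        T∌U i e = trans (lookup-─ S T i) (trans (cong (λ z → lookup S i ∧ not z) e) (∧-zeroʳ (lookup S i)))

        sides : ∀ {a b} → (a , b) ∈ A → (lookup T a ≡ true × lookup T b ≡ true) ⊎ (lookup U a ≡ true × lookup U b ≡ true)
        sides m = Sum.map (∧-elim _ _) (∧-elim _ _) (∨-elim _ _ (splits m))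

        A₁-inside : Inside T A₁
        A₁-inside m = Prod.map mk mk (∧-elim _ _ (proj₂ (filterᵇ-∈⁻ (edgeIn T) A m)))

        A₂-inside : Inside U A₂
        A₂-inside m = Prod.map mk mk (∧-elim _ _ (proj₂ (filterᵇ-∈⁻ (edgeIn U) A m)))

      components₁ : components T A₁ ≡ components T A
      components₁ = components-restrict (edgeIn T) T A (λ _ → ∧-elim _ _) outside-T
        where
        outside-T : ∀ {a b} → (a , b) ∈ A → edgeIn T (a , b) ≡ false → lookup T a ≡ false × lookup T b ≡ false
        outside-T m e with sides m
        ... | inj₁ (p , q) = ⊥-elim (true≢false (∧-intro p q) e)
        ... | inj₂ (p , q) = U∌T _ p , U∌T _ q

      components₂ : components U A₂ ≡ components U A
      components₂ = components-restrict (edgeIn U) U A (λ _ → ∧-elim _ _) outside-U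
        where
        outside-U : ∀ {a b} → (a , b) ∈ A → edgeIn U (a , b) ≡ false → lookup U a ≡ false × lookup U b ≡ false
        outside-U m e with sides m
        ... | inj₂ (p , q) = ⊥-elim (true≢false (∧-intro p q) e)
        ... | inj₁ (p , q) = T∌U _ p , T∌U _ q

      components-additive : components S A ≡ components T A + components U A
      components-additive =
        trans (cong (λ X → components X A) (sym (∪─ S T T⊆S)))
              (components-∪ T U A (λ i p q → true≢false (get p) (U∌T i (get q)))
                (λ u w uT wU c → true≢false (get (conn-closed T T-closed uT c)) (U∌T w (get wU))))
        where
        T-closed : Closed A T
        T-closed m with sides m
        ... | inj₁ (p , q) = (λ _ → mk q) , (λ _ → mk p)
        ... | inj₂ (p , q) = (λ x → ⊥-elim (true≢false (get x) (U∌T _ p))) , (λ x → ⊥-elim (true≢false (get x) (U∌T _ q)))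

      -- rank additivity follows from the rank formula on S, T and U
      rk-additive : rk A ≡ rk A₁ + rk A₂
      rk-additive = ℕP.+-cancelʳ-≡ (components T A + components U A) (rk A) (rk A₁ + rk A₂) (begin
        rk A + (components T A + components U A)   ≡⟨ cong (rk A +_) (sym components-additive) ⟩
        rk A + components S A                      ≡⟨ rank-formula S A A-inside ⟩
        sizeˢ S                                    ≡⟨ size-split S T T⊆S ⟩
        sizeˢ T + sizeˢ U                          ≡⟨ cong₂ _+_ (sym (rank-formula T A₁ A₁-inside)) (sym (rank-formula U A₂ A₂-inside)) ⟩
        (rk A₁ + components T A₁) + (rk A₂ + components U A₂)
          ≡⟨ cong₂ (λ a b → (rk A₁ + a) + (rk A₂ + b)) components₁ components₂ ⟩
        (rk A₁ + components T A) + (rk A₂ + components U A)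
          ≡⟨ +-interchange (rk A₁) (components T A) (rk A₂) (components U A) ⟩
        (rk A₁ + rk A₂) + (components T A + components U A) ∎)
        where open ≡-Reasoning

      nul-additive : nul A ≡ nul A₁ + nul A₂
      nul-additive = trans (cong₂ _∸_ length-additive rk-additive)
                           (∸-+-distrib (length A₁) (length A₂) (rk A₁) (rk A₂) (rk≤length A₁) (rk≤length A₂))
        where
        disjoint : ∀ e → edgeIn T e ∧ edgeIn U e ≡ false
        disjoint (a , b) with lookup T a in e
        ... | false = refl
        ... | true rewrite T∌U a e = ∧-zeroʳ _
        length-additive : length A ≡ length A₁ + length A₂
        length-additive = length-partition (edgeIn T) (edgeIn U) A (λ { (a , b) m → splits m }) (λ e _ → disjoint e)

open GraphTheory

module FiniteSums {c ℓ : Level} (R : CommutativeRing c ℓ) where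
  open import Data.Bool using (Bool; true; false; _∧_; _∨_; not; if_then_else_)
  open import Data.Nat as ℕ using (ℕ; zero; suc; _≤_)
  open import Data.Fin.Subset using (Subset; ⊥; _∪_; inside; outside)
  open import Data.Vec using ([]; _∷_; lookup)
  open import Data.List using (List; []; _∷_; map; _++_)
  open import Data.List.Membership.Propositional using (_∈_)
  open import Data.List.Relation.Unary.Any using (here; there)
  open import Data.Product using (_×_; _,_)
  open import Data.Sum using (_⊎_; inj₁; inj₂)
  open import Data.Empty using (⊥-elim)
  open import Data.Fin as Fin using (Fin)
  open import Relation.Binary.PropositionalEquality using (_≡_; refl; sym; cong; cong₂)
  open import Algebra.Bundles using (CommutativeMonoid)
  open import Function using (_∘_)

  open WithRing R renaming (refl to ≈-refl; sym to ≈-sym; trans to ≈-trans)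
  open import Relation.Binary.Reasoning.Setoid setoid
  open import Algebra.Properties.CommutativeSemigroup
    (CommutativeMonoid.commutativeSemigroup +-commutativeMonoid) using () renaming (interchange to +-interchange)
  open import Algebra.Properties.CommutativeSemigroup
    (CommutativeMonoid.commutativeSemigroup *-commutativeMonoid) using () renaming (interchange to *-interchange) public

  ≡⇒≈ : ∀ {a b} → a ≡ b → a ≈ b
  ≡⇒≈ refl = ≈-refl

  module _ {A : Set} where

    Σ-cong-∈ : ∀ {f g : A → Carrier} xs → (∀ x → x ∈ xs → f x ≈ g x) → Σ f xs ≈ Σ g xs
    Σ-cong-∈ []       h = ≈-refl
    Σ-cong-∈ (x ∷ xs) h = +-cong (h x (here refl)) (Σ-cong-∈ xs (λ y m → h y (there m)))

    Σ-cong : ∀ {f g : A → Carrier} xs → (∀ x → f x ≈ g x) → Σ f xs ≈ Σ g xs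
    Σ-cong xs h = Σ-cong-∈ xs (λ x _ → h x)

    Σ-zero : ∀ (f : A → Carrier) xs → (∀ x → x ∈ xs → f x ≈ 0#) → Σ f xs ≈ 0#
    Σ-zero f []       h = ≈-refl
    Σ-zero f (x ∷ xs) h = ≈-trans (+-cong (h x (here refl)) (Σ-zero f xs (λ y m → h y (there m)))) (+-identityˡ 0#)

    Σ-++ : ∀ (f : A → Carrier) xs ys → Σ f (xs ++ ys) ≈ Σ f xs + Σ f ys
    Σ-++ f []       ys = ≈-sym (+-identityˡ _)
    Σ-++ f (x ∷ xs) ys = ≈-trans (+-cong ≈-refl (Σ-++ f xs ys)) (≈-sym (+-assoc _ _ _))

    Σ-+ : ∀ (f g : A → Carrier) xs → Σ (λ x → f x + g x) xs ≈ Σ f xs + Σ g xs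
    Σ-+ f g []       = ≈-sym (+-identityˡ 0#)
    Σ-+ f g (x ∷ xs) = ≈-trans (+-cong ≈-refl (Σ-+ f g xs)) (+-interchange _ _ _ _)

    Σ-*ˡ : ∀ a (f : A → Carrier) xs → a * Σ f xs ≈ Σ (λ x → a * f x) xs
    Σ-*ˡ a f []       = zeroʳ a
    Σ-*ˡ a f (x ∷ xs) = ≈-trans (distribˡ a _ _) (+-cong ≈-refl (Σ-*ˡ a f xs))

    Σ-*ʳ : ∀ a (f : A → Carrier) xs → Σ f xs * a ≈ Σ (λ x → f x * a) xs
    Σ-*ʳ a f xs = ≈-trans (*-comm _ a) (≈-trans (Σ-*ˡ a f xs) (Σ-cong xs (λ x → *-comm a (f x))))

  Σ-map : ∀ {A B : Set} (f : B → Carrier) (g : A → B) xs → Σ f (map g xs) ≈ Σ (f ∘ g) xs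
  Σ-map f g []       = ≈-refl
  Σ-map f g (x ∷ xs) = +-cong ≈-refl (Σ-map f g xs)

  Σ-swap : ∀ {A B : Set} (f : A → B → Carrier) xs ys →
           Σ (λ x → Σ (f x) ys) xs ≈ Σ (λ y → Σ (λ x → f x y) xs) ys
  Σ-swap f []       ys = ≈-sym (Σ-zero (λ _ → 0#) ys (λ _ _ → ≈-refl))
  Σ-swap f (x ∷ xs) ys = ≈-trans (+-cong ≈-refl (Σ-swap f xs ys)) (≈-sym (Σ-+ _ _ ys))

  Σ-*-Σ : ∀ {A B : Set} (f : A → Carrier) (g : B → Carrier) xs ys →
          Σ f xs * Σ g ys ≈ Σ (λ x → Σ (λ y → f x * g y) ys) xs
  Σ-*-Σ f g xs ys = ≈-trans (Σ-*ʳ _ f xs) (Σ-cong xs (λ x → Σ-*ˡ (f x) g ys))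

  ind : Bool → Carrier → Carrier
  ind b y = if b then y else 0#

  ind-cong : ∀ b {y z} → y ≈ z → ind b y ≈ ind b z
  ind-cong true  e = e
  ind-cong false e = ≈-refl

  ind-false : ∀ {b} y → b ≡ false → ind b y ≈ 0#
  ind-false y refl = ≈-refl

  ind-∧ : ∀ b a y → ind (b ∧ a) y ≈ ind b (ind a y)
  ind-∧ true  a y = ≈-refl
  ind-∧ false a y = ≈-refl

  ind-* : ∀ a b p q → ind a p * ind b q ≈ ind a (ind b (p * q))
  ind-* true  true  p q = ≈-refl
  ind-* true  false p q = zeroʳ p
  ind-* false b     p q = zeroˡ _

  ind-∨ : ∀ a b y → a ∧ b ≡ false → ind (a ∨ b) y ≈ ind a y + ind b y
  ind-∨ true  false y _ = ≈-sym (+-identityʳ _)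
  ind-∨ false true  y _ = ≈-sym (+-identityˡ _)
  ind-∨ false false y _ = ≈-sym (+-identityˡ _)

  Σ-filter : ∀ {A : Set} (f : A → Carrier) (p : A → Bool) xs →
             Σ f (filterᵇ p xs) ≈ Σ (λ x → ind (p x) (f x)) xs
  Σ-filter f p [] = ≈-refl
  Σ-filter f p (x ∷ xs) with p x
  ... | true  = +-cong ≈-refl (Σ-filter f p xs)
  ... | false = ≈-trans (Σ-filter f p xs) (≈-sym (+-identityˡ _))

  Σ-partition : ∀ {A : Set} (f : A → Carrier) (p : A → Bool) xs →
                Σ f xs ≈ Σ f (filterᵇ p xs) + Σ f (filterᵇ (not ∘ p) xs)
  Σ-partition f p xs = ≈-sym (begin
    Σ f (filterᵇ p xs) + Σ f (filterᵇ (not ∘ p) xs)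
      ≈⟨ +-cong (Σ-filter f p xs) (Σ-filter f (not ∘ p) xs) ⟩
    Σ (λ x → ind (p x) (f x)) xs + Σ (λ x → ind (not (p x)) (f x)) xs
      ≈⟨ ≈-sym (Σ-+ _ _ xs) ⟩
    Σ (λ x → ind (p x) (f x) + ind (not (p x)) (f x)) xs
      ≈⟨ Σ-cong xs (λ x → either-or (p x) (f x)) ⟩
    Σ f xs ∎)
    where
    either-or : ∀ b y → ind b y + ind (not b) y ≈ y
    either-or true  y = +-identityʳ y
    either-or false y = +-identityˡ y

  ^-cong : ∀ {a b} m → a ≈ b → a ^ m ≈ b ^ m
  ^-cong zero    e = ≈-refl
  ^-cong (suc m) e = *-cong e (^-cong m e)

  ^-+ : ∀ a m k → a ^ (m ℕ.+ k) ≈ a ^ m * a ^ k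
  ^-+ a zero    k = ≈-sym (*-identityˡ _)
  ^-+ a (suc m) k = ≈-trans (*-cong ≈-refl (^-+ a m k)) (≈-sym (*-assoc _ _ _))

  ^-* : ∀ a b m → (a * b) ^ m ≈ a ^ m * b ^ m
  ^-* a b zero    = ≈-sym (*-identityˡ 1#)
  ^-* a b (suc m) = ≈-trans (*-cong ≈-refl (^-* a b m)) (*-interchange a b (a ^ m) (b ^ m))

  1^ : ∀ m → 1# ^ m ≈ 1#
  1^ zero    = ≈-refl
  1^ (suc m) = ≈-trans (*-identityˡ _) (1^ m)

  0^≥1 : ∀ m → 1 ≤ m → 0# ^ m ≈ 0#
  0^≥1 (suc m) _ = zeroˡ _

  ^-*-^ : ∀ a b r₁ r₂ n₁ n₂ → (a ^ r₁ * b ^ n₁) * (a ^ r₂ * b ^ n₂) ≈ a ^ (r₁ ℕ.+ r₂) * b ^ (n₁ ℕ.+ n₂)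
  ^-*-^ a b r₁ r₂ n₁ n₂ = ≈-trans (*-interchange _ _ _ _) (≈-sym (*-cong (^-+ a r₁ r₂) (^-+ b n₁ n₂)))

  module _ {E : Set} where

    Σ-sublists-∷ : ∀ (f : List E → Carrier) x xs →
                   Σ f (sublists (x ∷ xs)) ≈ Σ (f ∘ (x ∷_)) (sublists xs) + Σ f (sublists xs)
    Σ-sublists-∷ f x xs = ≈-trans (Σ-++ f (map (x ∷_) (sublists xs)) _) (+-cong (Σ-map f (x ∷_) (sublists xs)) ≈-refl)

    Σ-sublists-filter : ∀ (f : List E → Carrier) (p : E → Bool) xs →
      Σ f (sublists (filterᵇ p xs)) ≈ Σ (λ A → ind (allᵇ p A) (f A)) (sublists xs)
    Σ-sublists-filter f p [] = ≈-refl
    Σ-sublists-filter f p (x ∷ xs) with p x in e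
    ... | true = begin
      Σ f (sublists (x ∷ filterᵇ p xs))
        ≈⟨ Σ-sublists-∷ f x (filterᵇ p xs) ⟩
      Σ (f ∘ (x ∷_)) (sublists (filterᵇ p xs)) + Σ f (sublists (filterᵇ p xs))
        ≈⟨ +-cong (Σ-sublists-filter (f ∘ (x ∷_)) p xs) (Σ-sublists-filter f p xs) ⟩
      Σ (λ A → ind (allᵇ p A) (f (x ∷ A))) (sublists xs) + Σ (λ A → ind (allᵇ p A) (f A)) (sublists xs)
        ≈⟨ +-cong (Σ-cong (sublists xs) (λ A → ≡⇒≈ (cong (λ b → ind (b ∧ allᵇ p A) (f (x ∷ A))) (sym e)))) ≈-refl ⟩
      Σ (λ A → ind (allᵇ p (x ∷ A)) (f (x ∷ A))) (sublists xs) + Σ (λ A → ind (allᵇ p A) (f A)) (sublists xs)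
        ≈⟨ ≈-sym (Σ-sublists-∷ (λ A → ind (allᵇ p A) (f A)) x xs) ⟩
      Σ (λ A → ind (allᵇ p A) (f A)) (sublists (x ∷ xs)) ∎
    ... | false = begin
      Σ f (sublists (filterᵇ p xs))
        ≈⟨ Σ-sublists-filter f p xs ⟩
      Σ (λ A → ind (allᵇ p A) (f A)) (sublists xs)
        ≈⟨ ≈-sym (+-identityˡ _) ⟩
      0# + Σ (λ A → ind (allᵇ p A) (f A)) (sublists xs)
        ≈⟨ +-cong (≈-sym (Σ-zero _ (sublists xs) (λ A _ → ind-false (f (x ∷ A)) (cong (_∧ allᵇ p A) e)))) ≈-refl ⟩
      Σ (λ A → ind (allᵇ p (x ∷ A)) (f (x ∷ A))) (sublists xs) + Σ (λ A → ind (allᵇ p A) (f A)) (sublists xs)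
        ≈⟨ ≈-sym (Σ-sublists-∷ (λ A → ind (allᵇ p A) (f A)) x xs) ⟩
      Σ (λ A → ind (allᵇ p A) (f A)) (sublists (x ∷ xs)) ∎

    -- If every entry of ys satisfies exactly one of p, q, a sublist A of ys
    -- is the same as the pair (A|p, A|q) of sublists of ys|p and ys|q.
    ExactlyOne : (E → Bool) → (E → Bool) → E → Set
    ExactlyOne p q y = (p y ≡ true × q y ≡ false) ⊎ (p y ≡ false × q y ≡ true)

    Σ-sublists-pairs : ∀ (p q : E → Bool) ys → (∀ y → y ∈ ys → ExactlyOne p q y) →
      ∀ (k : List E → List E → Carrier) →
      Σ (λ A → k (filterᵇ p A) (filterᵇ q A)) (sublists ys)
        ≈ Σ (λ A₁ → Σ (k A₁) (sublists (filterᵇ q ys))) (sublists (filterᵇ p ys))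
    Σ-sublists-pairs p q [] one k = ≈-sym (+-identityʳ _)
    Σ-sublists-pairs p q (y ∷ ys) one k with one y (here refl)
    ... | inj₁ (py , qy) = begin
      Σ K (sublists (y ∷ ys))
        ≈⟨ Σ-sublists-∷ K y ys ⟩
      Σ (K ∘ (y ∷_)) (sublists ys) + Σ K (sublists ys)
        ≈⟨ +-cong (Σ-cong (sublists ys) (λ A → ≡⇒≈ (cong₂ k (filterᵇ-∷-true p A py) (filterᵇ-∷-false q A qy)))) ≈-refl ⟩
      Σ (λ A → k (y ∷ filterᵇ p A) (filterᵇ q A)) (sublists ys) + Σ K (sublists ys)
        ≈⟨ +-cong (Σ-sublists-pairs p q ys (λ z → one z ∘ there) (k ∘ (y ∷_))) (Σ-sublists-pairs p q ys (λ z → one z ∘ there) k) ⟩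
      Σ (λ A₁ → Σ (k (y ∷ A₁)) (sublists (filterᵇ q ys))) (sublists (filterᵇ p ys)) +
      Σ (λ A₁ → Σ (k A₁) (sublists (filterᵇ q ys))) (sublists (filterᵇ p ys))
        ≈⟨ ≈-sym (Σ-sublists-∷ (λ A₁ → Σ (k A₁) (sublists (filterᵇ q ys))) y (filterᵇ p ys)) ⟩
      Σ (λ A₁ → Σ (k A₁) (sublists (filterᵇ q ys))) (sublists (y ∷ filterᵇ p ys))
        ≈⟨ ≡⇒≈ (cong₂ (λ P Q → Σ (λ A₁ → Σ (k A₁) (sublists Q)) (sublists P))
                      (sym (filterᵇ-∷-true p ys py)) (sym (filterᵇ-∷-false q ys qy))) ⟩
      Σ (λ A₁ → Σ (k A₁) (sublists (filterᵇ q (y ∷ ys)))) (sublists (filterᵇ p (y ∷ ys))) ∎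
      where K = λ A → k (filterᵇ p A) (filterᵇ q A)
    ... | inj₂ (py , qy) = begin
      Σ K (sublists (y ∷ ys))
        ≈⟨ Σ-sublists-∷ K y ys ⟩
      Σ (K ∘ (y ∷_)) (sublists ys) + Σ K (sublists ys)
        ≈⟨ +-cong (Σ-cong (sublists ys) (λ A → ≡⇒≈ (cong₂ k (filterᵇ-∷-false p A py) (filterᵇ-∷-true q A qy)))) ≈-refl ⟩
      Σ (λ A → k (filterᵇ p A) (y ∷ filterᵇ q A)) (sublists ys) + Σ K (sublists ys)
        ≈⟨ +-cong (Σ-sublists-pairs p q ys (λ z → one z ∘ there) (λ A₁ A₂ → k A₁ (y ∷ A₂)))
                  (Σ-sublists-pairs p q ys (λ z → one z ∘ there) k) ⟩
      Σ (λ A₁ → Σ (k A₁ ∘ (y ∷_)) (sublists (filterᵇ q ys))) (sublists (filterᵇ p ys)) +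
      Σ (λ A₁ → Σ (k A₁) (sublists (filterᵇ q ys))) (sublists (filterᵇ p ys))
        ≈⟨ ≈-sym (Σ-+ _ _ (sublists (filterᵇ p ys))) ⟩
      Σ (λ A₁ → Σ (k A₁ ∘ (y ∷_)) (sublists (filterᵇ q ys)) + Σ (k A₁) (sublists (filterᵇ q ys))) (sublists (filterᵇ p ys))
        ≈⟨ Σ-cong (sublists (filterᵇ p ys)) (λ A₁ → ≈-sym (Σ-sublists-∷ (k A₁) y (filterᵇ q ys))) ⟩
      Σ (λ A₁ → Σ (k A₁) (sublists (y ∷ filterᵇ q ys))) (sublists (filterᵇ p ys))
        ≈⟨ ≡⇒≈ (cong₂ (λ P Q → Σ (λ A₁ → Σ (k A₁) (sublists Q)) (sublists P))
                      (sym (filterᵇ-∷-false p ys py)) (sym (filterᵇ-∷-true q ys qy))) ⟩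
      Σ (λ A₁ → Σ (k A₁) (sublists (filterᵇ q (y ∷ ys)))) (sublists (filterᵇ p (y ∷ ys))) ∎
      where K = λ A → k (filterᵇ p A) (filterᵇ q A)

  Σ-subsets-out : ∀ {m} (F : Subset (suc m) → Carrier) S →
                  Σ F (subsetsOf (outside ∷ S)) ≈ Σ (F ∘ (outside ∷_)) (subsetsOf S)
  Σ-subsets-out F S = Σ-map F (outside ∷_) (subsetsOf S)

  Σ-subsets-in : ∀ {m} (F : Subset (suc m) → Carrier) S →
                 Σ F (subsetsOf (inside ∷ S)) ≈ Σ (F ∘ (outside ∷_)) (subsetsOf S) + Σ (F ∘ (inside ∷_)) (subsetsOf S)
  Σ-subsets-in F S = ≈-trans (Σ-++ F (map (outside ∷_) (subsetsOf S)) _)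
                             (+-cong (Σ-map F (outside ∷_) (subsetsOf S)) (Σ-map F (inside ∷_) (subsetsOf S)))

  Σ-subsets-∪ : ∀ {m} (X Y : Subset m) → (∀ i → lookup X i ∧ lookup Y i ≡ false) → ∀ (F : Subset m → Carrier) →
                Σ F (subsetsOf (X ∪ Y)) ≈ Σ (λ T₁ → Σ (λ T₂ → F (T₁ ∪ T₂)) (subsetsOf Y)) (subsetsOf X)
  Σ-subsets-∪ [] [] _ F = ≈-sym (+-identityʳ _)
  Σ-subsets-∪ (true ∷ X) (true ∷ Y) h F with () ← h Fin.zero
  Σ-subsets-∪ (false ∷ X) (false ∷ Y) h F = begin
    Σ F (subsetsOf (outside ∷ (X ∪ Y)))
      ≈⟨ Σ-subsets-out F (X ∪ Y) ⟩
    Σ (F ∘ (outside ∷_)) (subsetsOf (X ∪ Y))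
      ≈⟨ Σ-subsets-∪ X Y (h ∘ Fin.suc) (F ∘ (outside ∷_)) ⟩
    Σ (λ T₁ → Σ (λ T₂ → F (outside ∷ (T₁ ∪ T₂))) (subsetsOf Y)) (subsetsOf X)
      ≈⟨ Σ-cong (subsetsOf X) (λ T₁ → ≈-sym (Σ-subsets-out (λ T₂ → F ((outside ∷ T₁) ∪ T₂)) Y)) ⟩
    Σ (λ T₁ → Σ (λ T₂ → F ((outside ∷ T₁) ∪ T₂)) (subsetsOf (outside ∷ Y))) (subsetsOf X)
      ≈⟨ ≈-sym (Σ-subsets-out (λ T₁ → Σ (λ T₂ → F (T₁ ∪ T₂)) (subsetsOf (outside ∷ Y))) X) ⟩
    Σ (λ T₁ → Σ (λ T₂ → F (T₁ ∪ T₂)) (subsetsOf (outside ∷ Y))) (subsetsOf (outside ∷ X)) ∎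
  Σ-subsets-∪ (true ∷ X) (false ∷ Y) h F = begin
    Σ F (subsetsOf (inside ∷ (X ∪ Y)))
      ≈⟨ Σ-subsets-in F (X ∪ Y) ⟩
    Σ (F ∘ (outside ∷_)) (subsetsOf (X ∪ Y)) + Σ (F ∘ (inside ∷_)) (subsetsOf (X ∪ Y))
      ≈⟨ +-cong (Σ-subsets-∪ X Y (h ∘ Fin.suc) (F ∘ (outside ∷_))) (Σ-subsets-∪ X Y (h ∘ Fin.suc) (F ∘ (inside ∷_))) ⟩
    Σ (λ T₁ → Σ (λ T₂ → F (outside ∷ (T₁ ∪ T₂))) (subsetsOf Y)) (subsetsOf X) +
    Σ (λ T₁ → Σ (λ T₂ → F (inside ∷ (T₁ ∪ T₂))) (subsetsOf Y)) (subsetsOf X)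
      ≈⟨ +-cong (Σ-cong (subsetsOf X) (λ T₁ → ≈-sym (Σ-subsets-out (λ T₂ → F ((outside ∷ T₁) ∪ T₂)) Y)))
                (Σ-cong (subsetsOf X) (λ T₁ → ≈-sym (Σ-subsets-out (λ T₂ → F ((inside ∷ T₁) ∪ T₂)) Y))) ⟩
    Σ (G ∘ (outside ∷_)) (subsetsOf X) + Σ (G ∘ (inside ∷_)) (subsetsOf X)
      ≈⟨ ≈-sym (Σ-subsets-in G X) ⟩
    Σ G (subsetsOf (inside ∷ X)) ∎
    where G = λ T₁ → Σ (λ T₂ → F (T₁ ∪ T₂)) (subsetsOf (outside ∷ Y))
  Σ-subsets-∪ (false ∷ X) (true ∷ Y) h F = begin
    Σ F (subsetsOf (inside ∷ (X ∪ Y)))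
      ≈⟨ Σ-subsets-in F (X ∪ Y) ⟩
    Σ (F ∘ (outside ∷_)) (subsetsOf (X ∪ Y)) + Σ (F ∘ (inside ∷_)) (subsetsOf (X ∪ Y))
      ≈⟨ +-cong (Σ-subsets-∪ X Y (h ∘ Fin.suc) (F ∘ (outside ∷_))) (Σ-subsets-∪ X Y (h ∘ Fin.suc) (F ∘ (inside ∷_))) ⟩
    Σ (λ T₁ → Σ (λ T₂ → F (outside ∷ (T₁ ∪ T₂))) (subsetsOf Y)) (subsetsOf X) +
    Σ (λ T₁ → Σ (λ T₂ → F (inside ∷ (T₁ ∪ T₂))) (subsetsOf Y)) (subsetsOf X)
      ≈⟨ ≈-sym (Σ-+ _ _ (subsetsOf X)) ⟩
    Σ (λ T₁ → Σ (λ T₂ → F (outside ∷ (T₁ ∪ T₂))) (subsetsOf Y) + Σ (λ T₂ → F (inside ∷ (T₁ ∪ T₂))) (subsetsOf Y)) (subsetsOf X)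
      ≈⟨ Σ-cong (subsetsOf X) (λ T₁ → ≈-sym (Σ-subsets-in (λ T₂ → F ((outside ∷ T₁) ∪ T₂)) Y)) ⟩
    Σ (λ T₁ → Σ (λ T₂ → F ((outside ∷ T₁) ∪ T₂)) (subsetsOf (inside ∷ Y))) (subsetsOf X)
      ≈⟨ ≈-sym (Σ-subsets-out (λ T₁ → Σ (λ T₂ → F (T₁ ∪ T₂)) (subsetsOf (inside ∷ Y))) X) ⟩
    Σ (λ T₁ → Σ (λ T₂ → F (T₁ ∪ T₂)) (subsetsOf (inside ∷ Y))) (subsetsOf (outside ∷ X)) ∎

  Σ-subsets-single : ∀ {m} (C X : Subset m) → X ⊆ C → ∀ (h : Subset m → Carrier) →
                     Σ (λ T → ind (sameᵇ T X) (h T)) (subsetsOf C) ≈ h X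
  Σ-subsets-single [] [] _ h = +-identityʳ _
  Σ-subsets-single (true ∷ C) (true ∷ X) X⊆C h = begin
    Σ (λ T → ind (sameᵇ T (true ∷ X)) (h T)) (subsetsOf (true ∷ C))
      ≈⟨ Σ-subsets-in (λ T → ind (sameᵇ T (true ∷ X)) (h T)) C ⟩
    Σ (λ T → 0#) (subsetsOf C) + Σ (λ T → ind (sameᵇ T X) (h (true ∷ T))) (subsetsOf C)
      ≈⟨ +-cong (Σ-zero _ (subsetsOf C) (λ _ _ → ≈-refl)) (Σ-subsets-single C X (X⊆C ∘ Fin.suc) (h ∘ (inside ∷_))) ⟩
    0# + h (true ∷ X)
      ≈⟨ +-identityˡ _ ⟩
    h (true ∷ X) ∎
  Σ-subsets-single (true ∷ C) (false ∷ X) X⊆C h = begin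
    Σ (λ T → ind (sameᵇ T (false ∷ X)) (h T)) (subsetsOf (true ∷ C))
      ≈⟨ Σ-subsets-in (λ T → ind (sameᵇ T (false ∷ X)) (h T)) C ⟩
    Σ (λ T → ind (sameᵇ T X) (h (false ∷ T))) (subsetsOf C) + Σ (λ T → 0#) (subsetsOf C)
      ≈⟨ +-cong (Σ-subsets-single C X (X⊆C ∘ Fin.suc) (h ∘ (outside ∷_))) (Σ-zero _ (subsetsOf C) (λ _ _ → ≈-refl)) ⟩
    h (false ∷ X) + 0#
      ≈⟨ +-identityʳ _ ⟩
    h (false ∷ X) ∎
  Σ-subsets-single (false ∷ C) (true ∷ X) X⊆C h with () ← X⊆C Fin.zero refl
  Σ-subsets-single (false ∷ C) (false ∷ X) X⊆C h =
    ≈-trans (Σ-subsets-out (λ T → ind (sameᵇ T (false ∷ X)) (h T)) C) (Σ-subsets-single C X (X⊆C ∘ Fin.suc) (h ∘ (outside ∷_)))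

  Σ-subsets-empty : ∀ {m} (S : Subset m) → (∀ i → lookup S i ≡ false) → ∀ (F : Subset m → Carrier) →
                    Σ F (subsetsOf S) ≈ F S
  Σ-subsets-empty []          h F = +-identityʳ _
  Σ-subsets-empty (true ∷ S)  h F with () ← h Fin.zero
  Σ-subsets-empty (false ∷ S) h F = ≈-trans (Σ-subsets-out F S) (Σ-subsets-empty S (h ∘ Fin.suc) (F ∘ (outside ∷_)))

  Σ-empty-subsets : ∀ {m} (S : Subset m) (F : Subset m → Carrier) → Σ F (filterᵇ isEmptyᵇ (subsetsOf S)) ≈ F ⊥
  Σ-empty-subsets S F = begin
    Σ F (filterᵇ isEmptyᵇ (subsetsOf S))
      ≈⟨ Σ-filter F isEmptyᵇ (subsetsOf S) ⟩
    Σ (λ T → ind (isEmptyᵇ T) (F T)) (subsetsOf S)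
      ≈⟨ Σ-cong (subsetsOf S) (λ T → ≡⇒≈ (cong (λ b → ind b (F T)) (isEmptyᵇ≡sameᵇ⊥ T))) ⟩
    Σ (λ T → ind (sameᵇ T ⊥) (F T)) (subsetsOf S)
      ≈⟨ Σ-subsets-single S ⊥ (λ i e → ⊥-elim (true≢false e (lookup-⊥ i))) F ⟩
    F ⊥ ∎

module Deformation {c ℓ : Level} (R : CommutativeRing c ℓ) where
  open import Data.Bool using (Bool; true; false; _∧_; _∨_; not; if_then_else_)
  open import Data.Bool.Properties using (∧-zeroʳ)
  open import Data.Nat as ℕ using (ℕ; zero; suc; _≤_; _<_; s≤s; _∸_)
  open import Data.Integer using (+_; -[1+_])
  import Data.Nat.Properties as ℕP
  open import Data.Fin as Fin using (Fin)
  open import Data.Fin.Subset using (Subset; ⊤; ⊥; _─_; _∪_; ∁)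
  open import Data.Vec using (lookup)
  open import Data.List using ([])
  open import Data.List.Membership.Propositional using (_∈_)
  open import Data.Product as Prod using (_×_; _,_; proj₁; proj₂)
  open import Data.Sum using (inj₁; inj₂)
  open import Data.Empty using (⊥-elim)
  open import Relation.Binary.PropositionalEquality using (_≡_; refl; sym; trans; cong; cong₂; subst)
  open import Function using (_∘_)

  open WithRing R renaming (refl to ≈-refl; sym to ≈-sym; trans to ≈-trans)
  open FiniteSums R
  open import Relation.Binary.Reasoning.Setoid setoid
  open import Algebra.Properties.Group +-group using (inverseˡ-unique; ε⁻¹≈ε)
  open import Algebra.Properties.AbelianGroup +-abelianGroup using (⁻¹-∙-comm)

  -- The proof peels off the component C of some vertex v: sets T split as
  -- T₁ ∪ T₂ with T₁ ⊆ C, T₂ ⊆ S ─ C, the summand factors, and T₁ ∈ {∅, C}.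

  module ComponentBinomial {n : ℕ} (A : Edges n) (s t : Carrier) where

    -- T is a union of components: no edge of A has exactly one end in T
    respectsᵇ : Subset n → Bool
    respectsᵇ T = allᵇ (λ e → lookup T (proj₁ e) ==ᵇ lookup T (proj₂ e)) A

    respectsᵇ-sound : ∀ T → respectsᵇ T ≡ true → Closed A T
    respectsᵇ-sound T e = same⇒Closed T λ m → ==ᵇ-sound (allᵇ-elim _ A e _ m)

    respectsᵇ-complete : ∀ T → Closed A T → respectsᵇ T ≡ true
    respectsᵇ-complete T c = allᵇ-intro _ A λ { (a , b) m → ≡⇒==ᵇ (Closed⇒same c m) }

    term : Subset n → Subset n → Carrier
    term S T = ind (respectsᵇ T) (s ^ components T A * t ^ components (S ─ T) A)

    term-empty : ∀ S → (∀ i → lookup S i ≡ false) → term S S ≈ (s + t) ^ components S A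
    term-empty S empty = begin
      ind (respectsᵇ S) (s ^ components S A * t ^ components (S ─ S) A)
        ≈⟨ ≡⇒≈ (cong (λ b → ind b (s ^ components S A * t ^ components (S ─ S) A)) (respectsᵇ-complete S (same⇒Closed S λ {a} {b} _ → trans (empty a) (sym (empty b))))) ⟩
      s ^ components S A * t ^ components (S ─ S) A
        ≈⟨ ≡⇒≈ (cong₂ (λ a b → s ^ a * t ^ b) (components-none S A empty) (components-none (S ─ S) A S─S-empty)) ⟩
      1# * 1#
        ≈⟨ *-identityˡ 1# ⟩
      1#
        ≈⟨ ≡⇒≈ (cong ((s + t) ^_) (sym (components-none S A empty))) ⟩
      (s + t) ^ components S A ∎
      where
      S─S-empty : ∀ i → lookup (S ─ S) i ≡ false
      S─S-empty i = trans (lookup-─ S S i) (trans (cong (λ b → b ∧ not b) (empty i)) refl)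

    module Peel (S : Subset n) (S-closed : Closed A S) (v : Fin n) (v∈S : lookup S v ≡ true) where

      C : Subset n
      C = reachWithin n A v

      S' : Subset n
      S' = S ─ C

      C-closed : Closed A C
      C-closed = reach-closed A v

      v∈C : lookup C v ≡ true
      v∈C = get (conn-refl {es = A} v)

      C⊆S : C ⊆ S
      C⊆S i e = get (conn-closed S S-closed (mk v∈S) (mk e))

      S'∌C : ∀ i → lookup S' i ≡ true → lookup C i ≡ false
      S'∌C i e = proj₂ (─-member S C i e)

      S'-smaller : sizeˢ S' < sizeˢ S
      S'-smaller = ℕP.≤-trans (ℕP.+-monoˡ-≤ (sizeˢ S') (member⇒size≥1 C v v∈C))
                              (ℕP.≤-reflexive (sym (size-split S C C⊆S)))

      components-apart : ∀ X Y → X ⊆ C → (∀ i → lookup Y i ≡ true → lookup C i ≡ false) →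
                         components (X ∪ Y) A ≡ components X A ℕ.+ components Y A
      components-apart X Y X⊆C Y∌C = components-∪ X Y A
        (λ i p q → true≢false (X⊆C i (get p)) (Y∌C i (get q)))
        (λ u w uX wY c → true≢false (get (conn-closed C C-closed (mk (X⊆C u (get uX))) c)) (Y∌C w (get wY)))

      components-C : components C A ≡ 1
      components-C = components-one C A v (mk v∈C) λ u w uC wC → conn-trans (conn-sym uC) wC

      components-S : components S A ≡ suc (components S' A)
      components-S = trans (cong (λ X → components X A) (sym (∪─ S C C⊆S)))
                    (trans (components-apart C S' (λ i e → e) S'∌C) (cong (ℕ._+ components S' A) components-C))

      term-factors : ∀ T₁ T₂ → T₁ ⊆ C → T₂ ⊆ S' → term S (T₁ ∪ T₂) ≈ term C T₁ * term S' T₂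
      term-factors T₁ T₂ T₁⊆C T₂⊆S' = begin
        ind (respectsᵇ (T₁ ∪ T₂)) (s ^ components (T₁ ∪ T₂) A * t ^ components (S ─ (T₁ ∪ T₂)) A)
          ≈⟨ ≡⇒≈ (cong₂ ind respects-∪ (cong₂ (λ a b → s ^ a * t ^ b) components-∪₁ components-∪₂)) ⟩
        ind (respectsᵇ T₁ ∧ respectsᵇ T₂)
            (s ^ (components T₁ A ℕ.+ components T₂ A) * t ^ (components (C ─ T₁) A ℕ.+ components (S' ─ T₂) A))
          ≈⟨ ind-∧ (respectsᵇ T₁) (respectsᵇ T₂) _ ⟩
        ind (respectsᵇ T₁) (ind (respectsᵇ T₂)
            (s ^ (components T₁ A ℕ.+ components T₂ A) * t ^ (components (C ─ T₁) A ℕ.+ components (S' ─ T₂) A)))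
          ≈⟨ ind-cong (respectsᵇ T₁) (ind-cong (respectsᵇ T₂) (≈-sym (^-*-^ s t (components T₁ A) (components T₂ A) (components (C ─ T₁) A) (components (S' ─ T₂) A)))) ⟩
        ind (respectsᵇ T₁) (ind (respectsᵇ T₂) ((s ^ components T₁ A * t ^ components (C ─ T₁) A) *
                                                (s ^ components T₂ A * t ^ components (S' ─ T₂) A)))
          ≈⟨ ≈-sym (ind-* (respectsᵇ T₁) (respectsᵇ T₂) _ _) ⟩
        term C T₁ * term S' T₂ ∎
        where
        T₂∌C : ∀ i → lookup T₂ i ≡ true → lookup C i ≡ false
        T₂∌C i e = S'∌C i (T₂⊆S' i e)
        respects-∪ : respectsᵇ (T₁ ∪ T₂) ≡ respectsᵇ T₁ ∧ respectsᵇ T₂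
        respects-∪ = allᵇ-∧ A λ { (a , b) m →
          trans (cong₂ _==ᵇ_ (lookup-∪ T₁ T₂ a) (lookup-∪ T₁ T₂ b))
            (==ᵇ-∨ (lookup C a) (lookup T₁ a) (lookup T₁ b) (lookup T₂ a) (lookup T₂ b)
               (T₁⊆C a) (λ e → trans (Closed⇒same C-closed m) (T₁⊆C b e))
               (T₂∌C a) (λ e → trans (Closed⇒same C-closed m) (T₂∌C b e))) }
        components-∪₁ : components (T₁ ∪ T₂) A ≡ components T₁ A ℕ.+ components T₂ A
        components-∪₁ = components-apart T₁ T₂ T₁⊆C T₂∌C
        components-∪₂ : components (S ─ (T₁ ∪ T₂)) A ≡ components (C ─ T₁) A ℕ.+ components (S' ─ T₂) A
        components-∪₂ = trans (cong (λ X → components X A) (─-∪ S C T₁ T₂ C⊆S T₁⊆C T₂⊆S'))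
          (components-apart (C ─ T₁) (S' ─ T₂) (λ i e → proj₁ (─-member C T₁ i e))
                            (λ i e → S'∌C i (proj₁ (─-member S' T₂ i e))))

      respects-in-C : ∀ T → T ⊆ C → respectsᵇ T ≡ sameᵇ T ⊥ ∨ sameᵇ T C
      respects-in-C T T⊆C = bool-ext to from
        where
        to : respectsᵇ T ≡ true → (sameᵇ T ⊥ ∨ sameᵇ T C) ≡ true
        to e with lookup T v in v∈?T
        ... | true  = ∨-introʳ (sameᵇ T ⊥) _ (subst (λ X → sameᵇ T X ≡ true) T≡C (sameᵇ-refl T))
          where
          T≡C : T ≡ C
          T≡C = subset-ext T C λ i → bool-ext (T⊆C i) (λ e' → get (conn-closed T (respectsᵇ-sound T e) (mk v∈?T) (mk e')))
        ... | false = ∨-introˡ _ _ (subst (λ X → sameᵇ T X ≡ true) T≡⊥ (sameᵇ-refl T))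
          where
          C⊆∁T : ∀ i → lookup C i ≡ true → lookup (∁ T) i ≡ true
          C⊆∁T i e' = get (conn-closed (∁ T) (Closed-∁ T (respectsᵇ-sound T e))
                                       (mk (trans (lookup-∁ T v) (cong not v∈?T))) (mk e'))
          T-empty : ∀ i → lookup T i ≡ false
          T-empty i = ¬true⇒false λ e' → true≢false (C⊆∁T i (T⊆C i e')) (trans (lookup-∁ T i) (cong not e'))
          T≡⊥ : T ≡ ⊥
          T≡⊥ = subset-ext T ⊥ (λ i → trans (T-empty i) (sym (lookup-⊥ i)))
        from : (sameᵇ T ⊥ ∨ sameᵇ T C) ≡ true → respectsᵇ T ≡ true
        from e with ∨-elim _ _ e
        ... | inj₁ e₁ rewrite sameᵇ-sound T ⊥ e₁ =
          respectsᵇ-complete ⊥ (same⇒Closed ⊥ λ {a} {b} _ → trans (lookup-⊥ a) (sym (lookup-⊥ b)))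
        ... | inj₂ e₂ rewrite sameᵇ-sound T C e₂ = respectsᵇ-complete C C-closed

      not-both : ∀ T → sameᵇ T ⊥ ∧ sameᵇ T C ≡ false
      not-both T with sameᵇ T ⊥ in e₁ | sameᵇ T C in e₂
      ... | true  | true  = ⊥-elim (true≢false (subst (λ X → lookup X v ≡ true)
                              (trans (sym (sameᵇ-sound T C e₂)) (sameᵇ-sound T ⊥ e₁)) v∈C) (lookup-⊥ v))
      ... | true  | false = refl
      ... | false | _     = refl

      Σ-term-C : Σ (term C) (subsetsOf C) ≈ s + t
      Σ-term-C = begin
        Σ (term C) (subsetsOf C)
          ≈⟨ Σ-cong-∈ (subsetsOf C) (λ T m → ≈-trans (≡⇒≈ (cong (λ r → ind r (h T)) (respects-in-C T (subsetsOf-⊆ C m))))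
                                                     (ind-∨ (sameᵇ T ⊥) (sameᵇ T C) (h T) (not-both T))) ⟩
        Σ (λ T → ind (sameᵇ T ⊥) (h T) + ind (sameᵇ T C) (h T)) (subsetsOf C)
          ≈⟨ Σ-+ _ _ (subsetsOf C) ⟩
        Σ (λ T → ind (sameᵇ T ⊥) (h T)) (subsetsOf C) + Σ (λ T → ind (sameᵇ T C) (h T)) (subsetsOf C)
          ≈⟨ +-cong (Σ-subsets-single C ⊥ (λ i e → ⊥-elim (true≢false e (lookup-⊥ i))) h) (Σ-subsets-single C C (λ i e → e) h) ⟩
        h ⊥ + h C
          ≈⟨ +-cong (≡⇒≈ (cong₂ (λ a b → s ^ a * t ^ b) (components-none ⊥ A lookup-⊥)
                                                       (trans (cong (λ X → components X A) (─⊥ C)) components-C)))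
                    (≡⇒≈ (cong₂ (λ a b → s ^ a * t ^ b) components-C (components-none (C ─ C) A C─C-empty))) ⟩
        1# * (t * 1#) + (s * 1#) * 1#
          ≈⟨ +-cong (≈-trans (*-identityˡ _) (*-identityʳ t)) (≈-trans (*-identityʳ _) (*-identityʳ s)) ⟩
        t + s
          ≈⟨ +-comm t s ⟩
        s + t ∎
        where
        h : Subset n → Carrier
        h T = s ^ components T A * t ^ components (C ─ T) A
        C─C-empty : ∀ i → lookup (C ─ C) i ≡ false
        C─C-empty i = trans (lookup-─ C C i) (complementary (lookup C i))
          where
          complementary : ∀ b → b ∧ not b ≡ false
          complementary true  = refl
          complementary false = refl

    Σ-term : ∀ k S → sizeˢ S < k → Closed A S → Σ (term S) (subsetsOf S) ≈ (s + t) ^ components S A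
    Σ-term (suc k) S (s≤s S<k) S-closed with empty-or-member S
    ... | inj₁ empty = ≈-trans (Σ-subsets-empty S empty (term S)) (term-empty S empty)
    ... | inj₂ (v , v∈S) = begin
        Σ (term S) (subsetsOf S)
          ≈⟨ ≡⇒≈ (cong (λ X → Σ (term S) (subsetsOf X)) (sym (∪─ S C C⊆S))) ⟩
        Σ (term S) (subsetsOf (C ∪ S'))
          ≈⟨ Σ-subsets-∪ C S' C-disjoint-S' (term S) ⟩
        Σ (λ T₁ → Σ (λ T₂ → term S (T₁ ∪ T₂)) (subsetsOf S')) (subsetsOf C)
          ≈⟨ Σ-cong-∈ (subsetsOf C) (λ T₁ m₁ → Σ-cong-∈ (subsetsOf S') (λ T₂ m₂ →
                term-factors T₁ T₂ (subsetsOf-⊆ C m₁) (subsetsOf-⊆ S' m₂))) ⟩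
        Σ (λ T₁ → Σ (λ T₂ → term C T₁ * term S' T₂) (subsetsOf S')) (subsetsOf C)
          ≈⟨ ≈-sym (Σ-*-Σ (term C) (term S') (subsetsOf C) (subsetsOf S')) ⟩
        Σ (term C) (subsetsOf C) * Σ (term S') (subsetsOf S')
          ≈⟨ *-cong Σ-term-C (Σ-term k S' (ℕP.<-≤-trans S'-smaller S<k) (Closed-─ S C S-closed C-closed)) ⟩
        (s + t) * (s + t) ^ components S' A
          ≈⟨ ≡⇒≈ (cong ((s + t) ^_) (sym components-S)) ⟩
        (s + t) ^ components S A ∎
      where
      open Peel S S-closed v v∈S
      C-disjoint-S' : ∀ i → lookup C i ∧ lookup S' i ≡ false
      C-disjoint-S' i with lookup S' i in e
      ... | true  rewrite S'∌C i e = refl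
      ... | false = ∧-zeroʳ (lookup C i)

  ⋆-cong : ∀ {φ φ' χ χ' : GFun} → (∀ G S → φ G S ≈ φ' G S) → (∀ G S → χ G S ≈ χ' G S) →
           ∀ G S → (φ ⋆ χ) G S ≈ (φ' ⋆ χ') G S
  ⋆-cong φ≈φ' χ≈χ' G S = Σ-cong (subsetsOf S) (λ T → *-cong (φ≈φ' G T) (χ≈χ' G (S ─ T)))

  module _ (x y : Carrier) where

    weight : ∀ {m} → Edges m → Carrier
    weight A = (x − 1#) ^ rk A * (y − 1#) ^ nul A

    ψ : Carrier → GFun
    ψ τ G S = Σ (λ A → τ ^ components S A * weight A) (sublists (inducedEdges G S))

    -- Expanding ψ_σ(T) ψ_τ(S ─ T)
    -- gives a sum over edge sets A of G whose edges lie inside T or inside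
    -- S ─ T; exchanging the sums over T and A, the inner sum over T is the
    -- binomial theorem over the components of (S, A).
    module Convolution (σ τ : Carrier) (G : Graph) (S : Subset (n G)) where

      E = edges G

      f : Subset (n G) → Carrier → Edges (n G) → Carrier
      f X κ A = κ ^ components X A * weight A

      splitsᵇ : Subset (n G) → Fin (n G) × Fin (n G) → Bool
      splitsᵇ T e = edgeIn T e ∨ edgeIn (S ─ T) e

      -- the contribution of A to ψ_σ(T) ψ_τ(S ─ T)
      H : Subset (n G) → Edges (n G) → Carrier
      H T A = ind (allᵇ (splitsᵇ T) A) (f T σ (filterᵇ (edgeIn T) A) * f (S ─ T) τ (filterᵇ (edgeIn (S ─ T)) A))

      not-both-sides : ∀ T e → edgeIn T e ∧ edgeIn (S ─ T) e ≡ false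
      not-both-sides T (a , b) with lookup T a in e
      ... | false = refl
      ... | true  rewrite lookup-─ S T a | e | ∧-zeroʳ (lookup S a) = ∧-zeroʳ (lookup T b)

      ψ-product : ∀ T → ψ σ G T * ψ τ G (S ─ T) ≈ Σ (H T) (sublists E)
      ψ-product T = begin
        ψ σ G T * ψ τ G (S ─ T)
          ≈⟨ Σ-*-Σ (f T σ) (f U τ) (sublists (filterᵇ (edgeIn T) E)) (sublists (filterᵇ (edgeIn U) E)) ⟩
        Σ (λ A₁ → Σ (λ A₂ → f T σ A₁ * f U τ A₂) (sublists (filterᵇ (edgeIn U) E))) (sublists (filterᵇ (edgeIn T) E))
          ≈⟨ ≡⇒≈ (cong₂ (λ P Q → Σ (λ A₁ → Σ (λ A₂ → f T σ A₁ * f U τ A₂) (sublists Q)) (sublists P))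
                        (sym (filterᵇ-absorb (edgeIn T) (splitsᵇ T) E (λ e → ∨-introˡ _ _)))
                        (sym (filterᵇ-absorb (edgeIn U) (splitsᵇ T) E (λ e → ∨-introʳ (edgeIn T e) _)))) ⟩
        Σ (λ A₁ → Σ (λ A₂ → f T σ A₁ * f U τ A₂) (sublists (filterᵇ (edgeIn U) ys))) (sublists (filterᵇ (edgeIn T) ys))
          ≈⟨ ≈-sym (Σ-sublists-pairs (edgeIn T) (edgeIn U) ys exactly-one (λ A₁ A₂ → f T σ A₁ * f U τ A₂)) ⟩
        Σ (λ A → f T σ (filterᵇ (edgeIn T) A) * f U τ (filterᵇ (edgeIn U) A)) (sublists ys)
          ≈⟨ Σ-sublists-filter _ (splitsᵇ T) E ⟩
        Σ (H T) (sublists E) ∎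
        where
        U = S ─ T
        ys = filterᵇ (splitsᵇ T) E
        exactly-one : ∀ e → e ∈ ys → ExactlyOne (edgeIn T) (edgeIn U) e
        exactly-one e m with edgeIn T e in e₁ | edgeIn U e in e₂
        ... | true  | false = inj₁ (refl , refl)
        ... | false | true  = inj₂ (refl , refl)
        ... | false | false = ⊥-elim (true≢false (subst (λ b → b ≡ true) (cong₂ _∨_ e₁ e₂) (proj₂ (filterᵇ-∈⁻ _ E m))) refl)
        ... | true  | true  = ⊥-elim (true≢false (cong₂ _∧_ e₁ e₂) (not-both-sides T e))

      H-outside : ∀ A T → T ⊆ S → allᵇ (edgeIn S) A ≡ false → H T A ≈ 0#
      H-outside A T T⊆S A⊈S with allᵇ (splitsᵇ T) A in A-splits
      ... | false = ≈-refl
      ... | true  = ⊥-elim (true≢false (allᵇ-intro (edgeIn S) A λ { (a , b) m → in-S a b (allᵇ-elim _ A A-splits _ m) }) A⊈S)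
        where
        in-S : ∀ a b → splitsᵇ T (a , b) ≡ true → edgeIn S (a , b) ≡ true
        in-S a b e with ∨-elim _ _ e
        ... | inj₁ e₁ = ∧-intro (T⊆S a (proj₁ (∧-elim _ _ e₁))) (T⊆S b (proj₂ (∧-elim _ _ e₁)))
        ... | inj₂ e₂ = ∧-intro (proj₁ (─-member S T a (proj₁ (∧-elim _ _ e₂)))) (proj₁ (─-member S T b (proj₂ (∧-elim _ _ e₂))))

      module _ (A : Edges (n G)) (A⊆S : allᵇ (edgeIn S) A ≡ true) where
        open ComponentBinomial A σ τ

        A-inside : Inside S A
        A-inside m = Prod.map mk mk (∧-elim _ _ (allᵇ-elim (edgeIn S) A A⊆S _ m))

        splits≡respects : ∀ T → allᵇ (splitsᵇ T) A ≡ respectsᵇ T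
        splits≡respects T = allᵇ-cong A λ { (a , b) m → split-edge S T a b (get (proj₁ (A-inside m))) (get (proj₂ (A-inside m))) }

        H-inside : ∀ T → T ⊆ S → H T A ≈ term S T * weight A
        H-inside T T⊆S with allᵇ (splitsᵇ T) A in A-splits
        ... | false = ≈-sym (≈-trans (*-cong (ind-false _ (trans (sym (splits≡respects T)) A-splits)) ≈-refl) (zeroˡ _))
        ... | true = begin
            f T σ A₁ * f (S ─ T) τ A₂
              ≈⟨ *-interchange _ _ _ _ ⟩
            (σ ^ components T A₁ * τ ^ components (S ─ T) A₂) * (weight A₁ * weight A₂)
              ≈⟨ *-cong (≡⇒≈ (cong₂ (λ p q → σ ^ p * τ ^ q) components₁ components₂))
                        (≈-trans (^-*-^ (x − 1#) (y − 1#) (rk A₁) (rk A₂) (nul A₁) (nul A₂))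
                                 (≡⇒≈ (cong₂ (λ p q → (x − 1#) ^ p * (y − 1#) ^ q) (sym rk-additive) (sym nul-additive)))) ⟩
            (σ ^ components T A * τ ^ components (S ─ T) A) * weight A
              ≈⟨ *-cong (≡⇒≈ (cong (λ b → ind b (σ ^ components T A * τ ^ components (S ─ T) A)) (trans (sym A-splits) (splits≡respects T)))) ≈-refl ⟩
            term S T * weight A ∎
          where open Split S T A T⊆S A-inside (λ m → allᵇ-elim _ A A-splits _ m)

      Σ-H : ∀ A → Σ (λ T → H T A) (subsetsOf S) ≈ ind (allᵇ (edgeIn S) A) (f S (σ + τ) A)
      Σ-H A with allᵇ (edgeIn S) A in A⊆S
      ... | false = Σ-zero _ (subsetsOf S) (λ T m → H-outside A T (subsetsOf-⊆ S m) A⊆S)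
      ... | true = begin
        Σ (λ T → H T A) (subsetsOf S)
          ≈⟨ Σ-cong-∈ (subsetsOf S) (λ T m → H-inside A A⊆S T (subsetsOf-⊆ S m)) ⟩
        Σ (λ T → term S T * weight A) (subsetsOf S)
          ≈⟨ ≈-sym (Σ-*ʳ (weight A) (term S) (subsetsOf S)) ⟩
        Σ (term S) (subsetsOf S) * weight A
          ≈⟨ *-cong (Σ-term (suc (sizeˢ S)) S ℕP.≤-refl S-closed) ≈-refl ⟩
        (σ + τ) ^ components S A * weight A ∎
        where
        open ComponentBinomial A σ τ
        S-closed : Closed A S
        S-closed m = (λ _ → proj₂ (A-inside A A⊆S m)) , (λ _ → proj₁ (A-inside A A⊆S m))

      convolution : (ψ σ ⋆ ψ τ) G S ≈ ψ (σ + τ) G S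
      convolution = begin
        Σ (λ T → ψ σ G T * ψ τ G (S ─ T)) (subsetsOf S)
          ≈⟨ Σ-cong (subsetsOf S) ψ-product ⟩
        Σ (λ T → Σ (H T) (sublists E)) (subsetsOf S)
          ≈⟨ Σ-swap H (subsetsOf S) (sublists E) ⟩
        Σ (λ A → Σ (λ T → H T A) (subsetsOf S)) (sublists E)
          ≈⟨ Σ-cong (sublists E) Σ-H ⟩
        Σ (λ A → ind (allᵇ (edgeIn S) A) (f S (σ + τ) A)) (sublists E)
          ≈⟨ ≈-sym (Σ-sublists-filter (f S (σ + τ)) (edgeIn S) E) ⟩
        ψ (σ + τ) G S ∎

    ψ-convolution : ∀ σ τ G S → (ψ σ ⋆ ψ τ) G S ≈ ψ (σ + τ) G S
    ψ-convolution σ τ G S = Convolution.convolution σ τ G S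

    ψ-cong : ∀ {κ κ'} → κ ≈ κ' → ∀ G S → ψ κ G S ≈ ψ κ' G S
    ψ-cong κ≈κ' G S = Σ-cong (sublists (inducedEdges G S)) (λ A → *-cong (^-cong (components S A) κ≈κ') ≈-refl)

    ρ≈ψ₁ : ∀ G S → ρ x y G S ≈ ψ 1# G S
    ρ≈ψ₁ G S = Σ-cong (sublists (inducedEdges G S)) (λ A → ≈-sym (≈-trans (*-cong (1^ (components S A)) ≈-refl) (*-identityˡ _)))

    -- on the empty vertex set only A = ∅ occurs, and it has no components
    ψ-empty : ∀ τ G S → (∀ i → lookup S i ≡ false) → ψ τ G S ≈ 1#
    ψ-empty τ G S empty = begin
      ψ τ G S
        ≈⟨ ≡⇒≈ (cong (λ L → Σ (λ A → τ ^ components S A * weight A) (sublists L)) no-edges) ⟩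
      τ ^ components S [] * (1# * 1#) + 0#
        ≈⟨ +-identityʳ _ ⟩
      τ ^ components S [] * (1# * 1#)
        ≈⟨ ≡⇒≈ (cong (λ k → τ ^ k * (1# * 1#)) (components-none S [] empty)) ⟩
      1# * (1# * 1#)
        ≈⟨ ≈-trans (*-identityˡ _) (*-identityˡ _) ⟩
      1# ∎
      where
      no-edges : inducedEdges G S ≡ []
      no-edges = filterᵇ-none _ (edges G) (λ e → cong (_∧ lookup S (proj₂ e)) (empty (proj₁ e)))

    ε≈ψ₀ : ∀ G S → ε G S ≈ ψ 0# G S
    ε≈ψ₀ G S with empty-or-member S
    ... | inj₁ empty rewrite isEmptyᵇ-empty S empty = ≈-sym (ψ-empty 0# G S empty)
    ... | inj₂ (v , v∈S) rewrite isEmptyᵇ-member S v v∈S =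
      ≈-sym (Σ-zero _ (sublists (inducedEdges G S)) λ A _ →
        ≈-trans (*-cong (0^≥1 (components S A) (components≥1 S A v (mk v∈S))) ≈-refl) (zeroˡ _))

    powℕ-ρ : ∀ m G S → powℕ (ρ x y) m G S ≈ ψ (fromℕ m) G S
    powℕ-ρ zero    G S = ε≈ψ₀ G S
    powℕ-ρ (suc m) G S = ≈-trans (⋆-cong ρ≈ψ₁ (powℕ-ρ m) G S) (ψ-convolution 1# (fromℕ m) G S)

    -- ψ_{-1} satisfies the recursion defining the inverse of ρ = ψ_1: by the
    -- convolution law Σ_{T ⊆ S} ψ_1(T) ψ_{-1}(S ─ T) = ψ_0(S) = ε(S)
    ψ₋₁-recursion : ∀ G S v → lookup S v ≡ true →
      ψ (- 1#) G S + Σ (λ T → ψ 1# G T * ψ (- 1#) G (S ─ T)) (filterᵇ (not ∘ isEmptyᵇ) (subsetsOf S)) ≈ 0#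
    ψ₋₁-recursion G S v v∈S = begin
      ψ (- 1#) G S + Σ F (filterᵇ (not ∘ isEmptyᵇ) (subsetsOf S))
        ≈⟨ +-cong empty-part ≈-refl ⟩
      Σ F (filterᵇ isEmptyᵇ (subsetsOf S)) + Σ F (filterᵇ (not ∘ isEmptyᵇ) (subsetsOf S))
        ≈⟨ ≈-sym (Σ-partition F isEmptyᵇ (subsetsOf S)) ⟩
      (ψ 1# ⋆ ψ (- 1#)) G S
        ≈⟨ ψ-convolution 1# (- 1#) G S ⟩
      ψ (1# + - 1#) G S
        ≈⟨ ψ-cong (-‿inverseʳ 1#) G S ⟩
      ψ 0# G S
        ≈⟨ ≈-sym (ε≈ψ₀ G S) ⟩
      ε G S
        ≈⟨ ≡⇒≈ (cong (λ b → if b then 1# else 0#) (isEmptyᵇ-member S v v∈S)) ⟩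
      0# ∎
      where
      F : Subset (n G) → Carrier
      F T = ψ 1# G T * ψ (- 1#) G (S ─ T)
      empty-part : ψ (- 1#) G S ≈ Σ F (filterᵇ isEmptyᵇ (subsetsOf S))
      empty-part = ≈-sym (begin
        Σ F (filterᵇ isEmptyᵇ (subsetsOf S)) ≈⟨ Σ-empty-subsets S F ⟩
        ψ 1# G ⊥ * ψ (- 1#) G (S ─ ⊥)        ≈⟨ *-cong (ψ-empty 1# G ⊥ lookup-⊥) (≡⇒≈ (cong (ψ (- 1#) G) (─⊥ S))) ⟩
        1# * ψ (- 1#) G S                     ≈⟨ *-identityˡ _ ⟩
        ψ (- 1#) G S ∎)

    invAux-ρ : ∀ f G S → sizeˢ S ≤ f → invAux f (ρ x y) G S ≈ ψ (- 1#) G S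
    invAux-ρ zero G S S≤0 rewrite isEmptyᵇ-empty S (size0⇒empty S S≤0) = ≈-sym (ψ-empty (- 1#) G S (size0⇒empty S S≤0))
    invAux-ρ (suc f) G S S≤1+f with empty-or-member S
    ... | inj₁ empty rewrite isEmptyᵇ-empty S empty = ≈-sym (ψ-empty (- 1#) G S empty)
    ... | inj₂ (v , v∈S) rewrite isEmptyᵇ-member S v v∈S = begin
        - Σ (λ T → ρ x y G T * invAux f (ρ x y) G (S ─ T)) nonempty
          ≈⟨ -‿cong (Σ-cong-∈ nonempty (λ T m → *-cong (ρ≈ψ₁ G T) (invAux-ρ f G (S ─ T) (rest-smaller T m)))) ⟩
        - Σ (λ T → ψ 1# G T * ψ (- 1#) G (S ─ T)) nonempty
          ≈⟨ ≈-sym (inverseˡ-unique _ _ (ψ₋₁-recursion G S v v∈S)) ⟩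
        ψ (- 1#) G S ∎
      where
      nonempty = filterᵇ (not ∘ isEmptyᵇ) (subsetsOf S)
      rest-smaller : ∀ T → T ∈ nonempty → sizeˢ (S ─ T) ≤ f
      rest-smaller T m with filterᵇ-∈⁻ (not ∘ isEmptyᵇ) (subsetsOf S) m
      ... | T∈ , T≠∅ = ℕP.≤-pred (ℕP.≤-trans (ℕP.+-monoˡ-≤ (sizeˢ (S ─ T)) (isEmptyᵇ-size T (not-elim T≠∅)))
                         (ℕP.≤-trans (ℕP.≤-reflexive (sym (size-split S T (subsetsOf-⊆ S T∈)))) S≤1+f))

    inverse-ρ : ∀ G S → inverse (ρ x y) G S ≈ ψ (- 1#) G S
    inverse-ρ G S = invAux-ρ (n G) G S (size≤n S)

    powℕ-inverse-ρ : ∀ m G S → powℕ (inverse (ρ x y)) m G S ≈ ψ (- fromℕ m) G S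
    powℕ-inverse-ρ zero    G S = ≈-trans (ε≈ψ₀ G S) (ψ-cong (≈-sym ε⁻¹≈ε) G S)
    powℕ-inverse-ρ (suc m) G S =
      ≈-trans (⋆-cong inverse-ρ (powℕ-inverse-ρ m) G S)
              (≈-trans (ψ-convolution (- 1#) (- fromℕ m) G S) (ψ-cong (⁻¹-∙-comm 1# (fromℕ m)) G S))

    powℤ-ρ : ∀ k G S → powℤ (ρ x y) k G S ≈ ψ (fromℤ k) G S
    powℤ-ρ (+ m)    = powℕ-ρ m
    powℤ-ρ -[1+ m ] = powℕ-inverse-ρ (suc m)

    -- For A ⊆ E(G) put d = rk G - rk A; then c(A) = c(G) + d, and the
    -- factor ((κ + x - 1)/(x - 1) - 1)^d (x-1)^d of the right side is κ^d.
    module _ (inv : Carrier) (inverse-x−1 : (x − 1#) * inv ≈ 1#) where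

      X-1 : ∀ κ → ((κ + (x − 1#)) * inv) − 1# ≈ κ * inv
      X-1 κ = begin
        (κ + (x − 1#)) * inv + - 1#         ≈⟨ +-cong (distribʳ inv κ (x − 1#)) ≈-refl ⟩
        (κ * inv + (x − 1#) * inv) + - 1#   ≈⟨ +-cong (+-cong ≈-refl inverse-x−1) ≈-refl ⟩
        (κ * inv + 1#) + - 1#               ≈⟨ +-assoc _ _ _ ⟩
        κ * inv + (1# + - 1#)               ≈⟨ +-cong ≈-refl (-‿inverseʳ 1#) ⟩
        κ * inv + 0#                        ≈⟨ +-identityʳ _ ⟩
        κ * inv ∎

      regroup : ∀ a b p q r z → a * ((p * q) * ((b * r) * z)) ≈ ((a * b) * (p * z)) * (q * r)
      regroup = solve 6 (λ a b p q r z → a ⊕ ((p ⊕ q) ⊕ ((b ⊕ r) ⊕ z)) ⊜ ((a ⊕ b) ⊕ (p ⊕ z)) ⊕ (q ⊕ r)) ≈-refl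
        where open import Algebra.Solver.CommutativeMonoid *-commutativeMonoid using (solve; _⊜_; _⊕_)

      ψ-Tutte : ∀ κ G → ψ κ G ⊤ ≈ κ ^ cInd G ⊤ * ((x − 1#) ^ rkInd G ⊤ * tutte G ⊤ ((κ + (x − 1#)) * inv) y)
      ψ-Tutte κ G = begin
        Σ (λ A → κ ^ components ⊤ A * weight A) (sublists E)
          ≈⟨ Σ-cong-∈ (sublists E) summand ⟩
        Σ (λ A → κ ^ cG * (u ^ rG * ((X − 1#) ^ (rG ∸ rk A) * (y − 1#) ^ nul A))) (sublists E)
          ≈⟨ ≈-sym (Σ-*ˡ (κ ^ cG) _ (sublists E)) ⟩
        κ ^ cG * Σ (λ A → u ^ rG * ((X − 1#) ^ (rG ∸ rk A) * (y − 1#) ^ nul A)) (sublists E)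
          ≈⟨ *-cong ≈-refl (≈-sym (Σ-*ˡ (u ^ rG) _ (sublists E))) ⟩
        κ ^ cG * (u ^ rG * tutte G ⊤ X y) ∎
        where
        u = x − 1#
        E = inducedEdges G ⊤
        cG = components ⊤ E
        rG = rk E
        X = (κ + u) * inv
        E-inside : Inside ⊤ E
        E-inside {a} {b} _ = mk (lookup-⊤ a) , mk (lookup-⊤ b)
        summand : ∀ A → A ∈ sublists E →
          κ ^ components ⊤ A * weight A ≈ κ ^ cG * (u ^ rG * ((X − 1#) ^ (rG ∸ rk A) * (y − 1#) ^ nul A))
        summand A A∈ = ≈-sym (begin
          κ ^ cG * (u ^ rG * ((X − 1#) ^ d * z))
            ≈⟨ *-cong ≈-refl (*-cong (≡⇒≈ (cong (u ^_) (sym rA+d≡rG))) (*-cong (^-cong d (X-1 κ)) ≈-refl)) ⟩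
          κ ^ cG * (u ^ (rA ℕ.+ d) * ((κ * inv) ^ d * z))
            ≈⟨ *-cong ≈-refl (*-cong (^-+ u rA d) (*-cong (^-* κ inv d) ≈-refl)) ⟩
          κ ^ cG * ((u ^ rA * u ^ d) * ((κ ^ d * inv ^ d) * z))
            ≈⟨ regroup (κ ^ cG) (κ ^ d) (u ^ rA) (u ^ d) (inv ^ d) z ⟩
          ((κ ^ cG * κ ^ d) * (u ^ rA * z)) * (u ^ d * inv ^ d)
            ≈⟨ *-cong ≈-refl (≈-trans (≈-sym (^-* u inv d)) (≈-trans (^-cong d inverse-x−1) (1^ d))) ⟩
          ((κ ^ cG * κ ^ d) * (u ^ rA * z)) * 1#
            ≈⟨ *-identityʳ _ ⟩
          (κ ^ cG * κ ^ d) * (u ^ rA * z)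
            ≈⟨ *-cong (≈-trans (≈-sym (^-+ κ cG d)) (≡⇒≈ (cong (κ ^_) cG+d≡cA))) ≈-refl ⟩
          κ ^ components ⊤ A * weight A ∎)
          where
          rA = rk A
          d = rG ∸ rA
          z = (y − 1#) ^ nul A
          drop = rank-drop ⊤ A E E-inside (sublists-⊆ E A∈)
          cG+d≡cA = proj₁ drop
          rA+d≡rG = proj₂ drop

-- ρ^k = ψ_k by the convolution law, and ψ_k is the Tutte expression by
-- the rank formula (only the inverse of x - 1 on one side is needed).
theorem4p1 : ∀ {c ℓ : Level} (R : CommutativeRing c ℓ) →
    let open WithRing R in
    (x y inv : Carrier) → (x − 1#) * inv ≈ 1# → inv * (x − 1#) ≈ 1# →
    (G : Graph) (k : ℤ) →
    powℤ (ρ x y) k G ⊤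
      ≈ (fromℤ k ^ cInd G ⊤) * (((x − 1#) ^ rkInd G ⊤) *
          tutte G ⊤ ((fromℤ k + (x − 1#)) * inv) y)
theorem4p1 R x y inv x−1·inv≈1 _ G k = begin
  powℤ (ρ x y) k G ⊤    ≈⟨ powℤ-ρ x y k G ⊤ ⟩
  ψ x y (fromℤ k) G ⊤   ≈⟨ ψ-Tutte x y inv x−1·inv≈1 (fromℤ k) G ⟩
  fromℤ k ^ cInd G ⊤ * ((x − 1#) ^ rkInd G ⊤ * tutte G ⊤ ((fromℤ k + (x − 1#)) * inv) y) ∎
  where
  open WithRing R
  open Deformation R
  open import Relation.Binary.Reasoning.Setoid setoid
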